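{- Let $m$ be a positive integer, $k\in\{2,3,4\}$ and $n\ge k-1$. There exists a polynomial $P\in U_{m,k}$ whose homogeneous component $\varphi_{m,k}(P)$ of degree $mn+(m+1)(k-1)-1$ lies in $W_{m,k}$ and is such that, when $\varphi_{m,k}(P)$ is written in the basis $\mathcal{B}_{m,k}$ of $W_{m,k}$, the coefficient of the basis element \[ (x_1\cdots x_n)^m\big(x_1^{(m+1)(k-1)-1}+\cdots+x_n^{(m+1)(k-1)-1}\big) \] is nonzero.
   Context: $mB^n=\{0,1,\ldots,m\}^n\subseteq\mathbb{R}^n$, $\mathbf{0}$ the origin. Multiplicity of $f$ at $\mathbf{a}$: the minimum total degree of monomials in $f(\mathbf{x}+\mathbf{a})$ ($\infty$ for $f=0$). For $k\ge2$, $V_{m,k}$ is the real vector space of polynomials $P\in\mathbb{R}[x_1,\ldots,x_n]$ with $\deg P\le mn+(m+1)(k-1)-1$ such that no monomial of $P$ is divisible by $x_{i_1}^{m+1}\cdots x_{i_k}^{m+1}$ for any (not necessarily distinct) indices $i_1,\ldots,i_k$; $U_{m,k}$ is the subspace of those $P\in V_{m,k}$ having zeros of multiplicity at least $k$ at all points of $mB^n\setminus\{\mathbf{0}\}$. $\varphi_{m,k}(P)$ denotes the homogeneous component of $P$ of degree $mn+(m+1)(k-1)-1$. $\mathcal{B}_{m,k}$ is the set of polynomials $(x_1\cdots x_n)^m(x_1^{l_1}\cdots x_n^{l_n})^{m+1}(x_1^d+\cdots+x_n^d)$ over all non-negative integers $d,l_1,\ldots,l_n$ with $d+(m+1)(l_1+\cdots+l_n)=(m+1)(k-1)-1$;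 $W_{m,k}$ is its linear span, and for $n\ge k-1$ these polynomials are linearly independent, so $\mathcal{B}_{m,k}$ is a basis of $W_{m,k}$. -}

module Defs where

open import Data.Nat as ℕ using (ℕ; zero; suc; _+_; _*_; _∸_; _^_; _≤_; _<_)
open import Data.Nat.Combinatorics using (_C_)
open import Data.Integer using (+_)
open import Data.Rational as ℚ using (ℚ; 0ℚ; _/_)
open import Data.Fin as Fin using (Fin)
open import Data.Vec as V using (Vec; tabulate; lookup; replicate)
open import Data.Vec.Properties using (≡-dec)
open import Data.List as L using (List)
open import Data.Product using (_×_; _,_; ∃)
open import Data.Bool using (if_then_else_; _∧_)
open import Relation.Nullary using (¬_; does)
open import Relation.Binary.PropositionalEquality using (_≡_; _≢_)

-- An exponent vector α ∈ ℕⁿ stands for the monomial x₁^α₁ ⋯ xₙ^αₙ.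
-- A polynomial is a formal finite sum of terms c · x^α, given as a list;
-- its actual coefficients are given by `coeff` (duplicates add up), and
-- all notions below are stated through `coeff`, i.e. independent of the
-- chosen list representation.

Exp : ℕ → Set
Exp n = Vec ℕ n

Poly : ℕ → Set
Poly n = List (ℚ × Exp n)

ℕtoℚ : ℕ → ℚ
ℕtoℚ k = (+ k) / 1

sumℚ : List ℚ → ℚ
sumℚ = L.foldr ℚ._+_ 0ℚ

_≟ₑ_ : ∀ {n} (α β : Exp n) → _
_≟ₑ_ = ≡-dec ℕ._≟_

tdeg : ∀ {n} → Exp n → ℕ
tdeg = V.sum

coeff : ∀ {n} → Poly n → Exp n → ℚ
coeff P e = sumℚ (L.map (λ { (c , α) → if does (α ≟ₑ e) then c else 0ℚ }) P)

-- coefficient of x^β in P(x + a)  (Taylor expansion: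
--   (x+a)^α = Σ_β Π_i C(α_i,β_i) a_i^(α_i-β_i) x^β )
coeffShift : ∀ {n} → Poly n → Vec ℕ n → Exp n → ℚ
coeffShift {n} P a β = sumℚ (L.map term P)
  where
  term : ℚ × Exp n → ℚ
  term (c , α) = c ℚ.* ℕtoℚ (V.foldr _ _*_ 1 (tabulate λ i →
                   (lookup α i C lookup β i) * (lookup a i ^ (lookup α i ∸ lookup β i))))

-- multiplicity of P at a is at least k: every monomial of P(x+a)
-- (i.e. with nonzero coefficient) has total degree ≥ k
MultAtLeast : ∀ {n} → ℕ → Poly n → Vec ℕ n → Set
MultAtLeast {n} k P a = ∀ (β : Exp n) → tdeg β < k → coeffShift P a β ≡ 0ℚ

topDeg : ℕ → ℕ → ℕ → ℕ
topDeg m n k = m * n + (suc m * (k ∸ 1)) ∸ 1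

countPre : ∀ {k n} → (Fin k → Fin n) → Fin n → ℕ
countPre {k} ι i = V.sum (tabulate {n = k} λ j → if does (ι j Fin.≟ i) then 1 else 0)

-- x^e is divisible by x_{ι 1}^{m+1} ⋯ x_{ι k}^{m+1}
-- (the latter monomial has exponent (m+1)·#ι⁻¹(i) in variable i)
DivBy : ∀ {n} (m k : ℕ) → (Fin k → Fin n) → Exp n → Set
DivBy {n} m k ι e = ∀ (i : Fin n) → suc m * countPre ι i ≤ lookup e i

InV : ∀ {n} (m k : ℕ) → Poly n → Set
InV {n} m k P =
  (∀ (e : Exp n) → coeff P e ≢ 0ℚ → tdeg e ≤ topDeg m n k) ×
  (∀ (e : Exp n) → coeff P e ≢ 0ℚ → ∀ (ι : Fin k → Fin n) → ¬ DivBy m k ι e)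

InU : ∀ {n} (m k : ℕ) → Poly n → Set
InU {n} m k P = InV m k P ×
  (∀ (a : Vec ℕ n) → (∀ i → lookup a i ≤ m) → a ≢ replicate n 0 → MultAtLeast k P a)

phiCoeff : ∀ {n} (m k : ℕ) → Poly n → Exp n → ℚ
phiCoeff {n} m k P e = if does (tdeg e ℕ.≟ topDeg m n k) then coeff P e else 0ℚ

-- coefficient of x^e in the element of B_{m,k} with parameters d, l:
--   (x₁⋯xₙ)^m (x₁^l₁⋯xₙ^lₙ)^(m+1) (x₁^d + ⋯ + xₙ^d)
basisCoeff : ∀ {n} (m d : ℕ) → Exp n → Exp n → ℚ
basisCoeff {n} m d l e = ℕtoℚ (V.sum (tabulate {n = n} λ j →
  if does (e ≟ₑ tabulate (λ i → m + suc m * lookup l i + (if does (i Fin.≟ j) then d else 0)))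
  then 1 else 0))

Admissible : ∀ {n} (m k : ℕ) → ℕ × Exp n → Set
Admissible m k (d , l) = d + suc m * tdeg l ≡ suc m * (k ∸ 1) ∸ 1

-- a linear combination of elements of B_{m,k}: list of (coefficient, (d, l))
Comb : ℕ → Set
Comb n = List (ℚ × (ℕ × Exp n))

Represents : ∀ {n} (m k : ℕ) → Comb n → Poly n → Set
Represents {n} m k R P = ∀ (e : Exp n) →
  phiCoeff m k P e ≡ sumℚ (L.map (λ { (c , (d , l)) → c ℚ.* basisCoeff m d l e }) R)

coeffOfB0 : ∀ {n} (m k : ℕ) → Comb n → ℚ
coeffOfB0 {n} m k R = sumℚ (L.map (λ { (c , (d , l)) →
  if does (d ℕ.≟ (suc m * (k ∸ 1) ∸ 1)) ∧ does (l ≟ₑ replicate n 0) then c else 0ℚ }) R)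

-- Let T = ∏_{j=1}^{m} (1 − x/j), so T(0) = 1 and T vanishes on {1, …, m}. For r = 1, 2, 3 pick
-- q of degree r − 1 with T^r q ≡ 1 mod x^r; then e_r = 1 − T^r q has degree (m+1)r − 1, equals
-- [x ≠ 0] on {0, …, m} and has vanishing derivatives of orders 1, …, r − 1 there. Consequently
-- Y_r = Σᵢ e_r(xᵢ) − 1 agrees to order r with s − 1 at every grid point a, where s is the number
-- of nonzero coordinates of a. The polynomials H₂ = Y₁, H₃ = Y₂ − Y₁², H₄ = Y₃ + Y₁³/2 − 3Y₂Y₁/2
-- vanish to order k − s whenever 1 ≤ s < k, and G = ∏ᵢ T(xᵢ) vanishes to order s, so P = G·H_k
-- has multiplicity k on the grid minus the origin. Every monomial of P divides x^m⃗ x^((m+1)t) with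
-- |t| ≤ k − 1, so none is divisible by a product of k powers x_i^(m+1). The top-degree part of H_k
-- is that of Y_{k−1}, a nonzero multiple of Σᵢ xᵢ^((m+1)(k−1)−1), since the products of the Y_r
-- have smaller degree; multiplied by the top-degree part c (x₁⋯xₙ)^m of G this gives φ(P).

module Submission where

open import Defs
open import Data.Nat as ℕ using (ℕ; zero; suc; _≤_; _<_; _∸_; z≤n; s≤s)
import Data.Nat.Properties as ℕP
open import Data.Nat.Combinatorics using (_C_)
import Data.Nat.Combinatorics as ℕC
import Data.Nat.Coprimality as Coprime
import Data.Nat.Solver as ℕSolver
import Data.Integer as ℤ
import Data.Integer.Properties as ℤP
import Data.Integer.GCD as ℤ
open import Data.Rational as ℚ using (ℚ; mkℚ; 0ℚ; 1ℚ; _+_; _*_; -_; ↥_; ↧_)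
import Data.Rational.Properties as ℚP
import Data.Rational.Unnormalised as ℚᵘ
import Data.Rational.Unnormalised.Properties as ℚᵘP
open import Data.Rational.Solver using (module +-*-Solver)
open import Data.Fin as Fin using (Fin)
open import Data.Vec as V using (Vec; []; _∷_; tabulate; lookup; replicate)
import Data.Vec.Properties as VP
import Data.Vec.Relation.Binary.Pointwise.Inductive as Pointwise
open Pointwise using (Pointwise; []; _∷_)
open import Data.List as L using (List; []; _∷_; _++_)
open import Data.List.Relation.Unary.All using (All; []; _∷_)
open import Data.Product using (_×_; _,_; proj₁; proj₂; ∃; ∃₂)
open import Data.Sum using (inj₁; inj₂)
open import Data.Empty using (⊥; ⊥-elim)
open import Data.Bool using (true; false; if_then_else_)
open import Function using (_∘_)
open import Algebra.Bundles using (CommutativeMonoid; CommutativeRing)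
import Algebra.Properties.CommutativeMonoid.Sum as MonoidSum
import Algebra.Properties.Semiring.Sum as SemiringSum
import Algebra.Properties.CommutativeSemigroup as CommSemigroupProperties
open import Relation.Nullary using (¬_; yes; no; does; Dec)
open import Relation.Nullary.Decidable using (dec-true; dec-false)
open import Relation.Binary.PropositionalEquality
open import Relation.Binary using (tri<; tri≈; tri>)

open +-*-Solver using (solve; _:+_; _:*_; _:=_; con; :-_)
open ℕSolver.+-*-Solver using () renaming (solve to solveℕ; _:+_ to _:+ℕ_; _:*_ to _:*ℕ_; _:=_ to _:=ℕ_; con to conℕ)

module ℕΣ = MonoidSum ℕP.+-0-commutativeMonoid
module ℚΣ = SemiringSum (CommutativeRing.semiring ℚP.+-*-commutativeRing)

ℕ-+-interchange : ∀ a b c d → (a ℕ.+ b) ℕ.+ (c ℕ.+ d) ≡ (a ℕ.+ c) ℕ.+ (b ℕ.+ d)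
ℕ-+-interchange = CommSemigroupProperties.interchange ℕP.+-commutativeSemigroup

+-interchange : ∀ a b c d → (a + b) + (c + d) ≡ (a + c) + (b + d)
+-interchange = CommSemigroupProperties.interchange (CommutativeMonoid.commutativeSemigroup ℚP.+-0-commutativeMonoid)

*-interchange : ∀ a b c d → (a * b) * (c * d) ≡ (a * c) * (b * d)
*-interchange = CommSemigroupProperties.interchange (CommutativeMonoid.commutativeSemigroup ℚP.*-1-commutativeMonoid)

ℕtoℚ≡mkℚ : ∀ k → ℕtoℚ k ≡ mkℚ (ℤ.+ k) 0 (Coprime.sym (Coprime.1-coprimeTo k))
ℕtoℚ≡mkℚ k = ℚP.≃⇒≡ (ℚ.*≡* (cong₂ ℤ._*_ numerator (sym denominator)))
  where
  numerator : ↥ ℕtoℚ k ≡ ℤ.+ k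
  numerator = trans (sym (ℤP.*-identityʳ _))
    (trans (cong (↥ ℕtoℚ k ℤ.*_) (sym (ℤ.gcd-zeroʳ (ℤ.+ k)))) (ℚP.↥-/ (ℤ.+ k) 1))
  denominator : ↧ ℕtoℚ k ≡ ℤ.1ℤ
  denominator = trans (sym (ℤP.*-identityʳ _))
    (trans (cong (↧ ℕtoℚ k ℤ.*_) (sym (ℤ.gcd-zeroʳ (ℤ.+ k)))) (ℚP.↧-/ (ℤ.+ k) 1))

toℚᵘ-ℕtoℚ : ∀ k → ℚ.toℚᵘ (ℕtoℚ k) ≡ ℚᵘ.mkℚᵘ (ℤ.+ k) 0
toℚᵘ-ℕtoℚ k = cong ℚ.toℚᵘ (ℕtoℚ≡mkℚ k)

ℕtoℚ-+ : ∀ a b → ℕtoℚ (a ℕ.+ b) ≡ ℕtoℚ a + ℕtoℚ b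
ℕtoℚ-+ a b = ℚP.toℚᵘ-injective (begin
  ℚ.toℚᵘ (ℕtoℚ (a ℕ.+ b))               ≡⟨ toℚᵘ-ℕtoℚ (a ℕ.+ b) ⟩
  ℚᵘ.mkℚᵘ (ℤ.+ (a ℕ.+ b)) 0               ≈⟨ ℚᵘ.*≡* numerators ⟩
  ℚᵘ.mkℚᵘ (ℤ.+ a) 0 ℚᵘ.+ ℚᵘ.mkℚᵘ (ℤ.+ b) 0   ≡⟨ sym (cong₂ ℚᵘ._+_ (toℚᵘ-ℕtoℚ a) (toℚᵘ-ℕtoℚ b)) ⟩
  ℚ.toℚᵘ (ℕtoℚ a) ℚᵘ.+ ℚ.toℚᵘ (ℕtoℚ b)  ≈⟨ ℚᵘP.≃-sym (ℚP.toℚᵘ-homo-+ (ℕtoℚ a) (ℕtoℚ b)) ⟩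
  ℚ.toℚᵘ (ℕtoℚ a + ℕtoℚ b)              ∎)
  where
  open ℚᵘP.≃-Reasoning
  numerators : ℤ.+ (a ℕ.+ b) ℤ.* ℤ.1ℤ ≡ (ℤ.+ a ℤ.* ℤ.1ℤ ℤ.+ ℤ.+ b ℤ.* ℤ.1ℤ) ℤ.* ℤ.1ℤ
  numerators = trans (ℤP.*-identityʳ _) (trans (ℤP.pos-+ a b)
    (sym (trans (ℤP.*-identityʳ _) (cong₂ ℤ._+_ (ℤP.*-identityʳ (ℤ.+ a)) (ℤP.*-identityʳ (ℤ.+ b))))))

ℕtoℚ-* : ∀ a b → ℕtoℚ (a ℕ.* b) ≡ ℕtoℚ a * ℕtoℚ b
ℕtoℚ-* a b = ℚP.toℚᵘ-injective (begin
  ℚ.toℚᵘ (ℕtoℚ (a ℕ.* b))               ≡⟨ toℚᵘ-ℕtoℚ (a ℕ.* b) ⟩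
  ℚᵘ.mkℚᵘ (ℤ.+ (a ℕ.* b)) 0               ≈⟨ ℚᵘ.*≡* (cong (ℤ._* ℤ.1ℤ) (ℤP.pos-* a b)) ⟩
  ℚᵘ.mkℚᵘ (ℤ.+ a) 0 ℚᵘ.* ℚᵘ.mkℚᵘ (ℤ.+ b) 0   ≡⟨ sym (cong₂ ℚᵘ._*_ (toℚᵘ-ℕtoℚ a) (toℚᵘ-ℕtoℚ b)) ⟩
  ℚ.toℚᵘ (ℕtoℚ a) ℚᵘ.* ℚ.toℚᵘ (ℕtoℚ b)  ≈⟨ ℚᵘP.≃-sym (ℚP.toℚᵘ-homo-* (ℕtoℚ a) (ℕtoℚ b)) ⟩
  ℚ.toℚᵘ (ℕtoℚ a * ℕtoℚ b)              ∎)
  where open ℚᵘP.≃-Reasoning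

ℕtoℚ-suc-positive : ∀ j → ℚ.Positive (ℕtoℚ (suc j))
ℕtoℚ-suc-positive j = subst ℚ.Positive (sym (ℕtoℚ≡mkℚ (suc j))) _

ℕtoℚ-suc-nonZero : ∀ j → ℚ.NonZero (ℕtoℚ (suc j))
ℕtoℚ-suc-nonZero j = ℚP.pos⇒nonZero (ℕtoℚ (suc j)) {{ℕtoℚ-suc-positive j}}

*-≢0 : ∀ {x y} → x ≢ 0ℚ → y ≢ 0ℚ → x * y ≢ 0ℚ
*-≢0 {x} {y} x≢0 y≢0 xy≡0 = y≢0 (begin
  y                 ≡⟨ sym (ℚP.*-identityˡ y) ⟩
  1ℚ * y            ≡⟨ cong (_* y) (sym (ℚP.*-inverseˡ x)) ⟩
  x⁻¹ * x * y       ≡⟨ ℚP.*-assoc x⁻¹ x y ⟩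
  x⁻¹ * (x * y)     ≡⟨ cong (x⁻¹ *_) xy≡0 ⟩
  x⁻¹ * 0ℚ          ≡⟨ ℚP.*-zeroʳ x⁻¹ ⟩
  0ℚ                ∎)
  where
  open ≡-Reasoning
  instance x-nonZero = ℚ.≢-nonZero x≢0
  x⁻¹ = ℚ.1/ x

*≢0⇒≢0 : ∀ {x y} → x * y ≢ 0ℚ → x ≢ 0ℚ × y ≢ 0ℚ
*≢0⇒≢0 {x} {y} xy≢0 = (λ x≡0 → xy≢0 (trans (cong (_* y) x≡0) (ℚP.*-zeroˡ y)))
                    , (λ y≡0 → xy≢0 (trans (cong (x *_) y≡0) (ℚP.*-zeroʳ x)))

*≡0⇐¬both≢0 : ∀ {x y} → (x ≢ 0ℚ → y ≢ 0ℚ → ⊥) → x * y ≡ 0ℚ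
*≡0⇐¬both≢0 {x} {y} ¬both with x ℚP.≟ 0ℚ | y ℚP.≟ 0ℚ
... | yes x≡0 | _        = trans (cong (_* y) x≡0) (ℚP.*-zeroˡ y)
... | no _    | yes y≡0 = trans (cong (x *_) y≡0) (ℚP.*-zeroʳ x)
... | no x≢0  | no y≢0  = ⊥-elim (¬both x≢0 y≢0)

sumOver : ∀ {A : Set} → List A → (A → ℚ) → ℚ
sumOver xs f = sumℚ (L.map f xs)

module _ {A : Set} where

  sumOver-cong : ∀ (xs : List A) {f g} → (∀ x → f x ≡ g x) → sumOver xs f ≡ sumOver xs g
  sumOver-cong []       eq = refl
  sumOver-cong (x ∷ xs) eq = cong₂ _+_ (eq x) (sumOver-cong xs eq)

  sumOver-zero : ∀ (xs : List A) → sumOver xs (λ _ → 0ℚ) ≡ 0ℚ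
  sumOver-zero []       = refl
  sumOver-zero (x ∷ xs) = trans (ℚP.+-identityˡ _) (sumOver-zero xs)

  sumOver-++ : ∀ (xs ys : List A) f → sumOver (xs ++ ys) f ≡ sumOver xs f + sumOver ys f
  sumOver-++ []       ys f = sym (ℚP.+-identityˡ _)
  sumOver-++ (x ∷ xs) ys f = trans (cong (f x +_) (sumOver-++ xs ys f)) (sym (ℚP.+-assoc (f x) _ _))

  sumOver-*ˡ : ∀ (xs : List A) c f → sumOver xs (λ x → c * f x) ≡ c * sumOver xs f
  sumOver-*ˡ []       c f = sym (ℚP.*-zeroʳ c)
  sumOver-*ˡ (x ∷ xs) c f = trans (cong (c * f x +_) (sumOver-*ˡ xs c f)) (sym (ℚP.*-distribˡ-+ c (f x) _))

  sumOver-*ʳ : ∀ (xs : List A) c f → sumOver xs (λ x → f x * c) ≡ sumOver xs f * c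
  sumOver-*ʳ xs c f = trans (sumOver-cong xs (λ x → ℚP.*-comm (f x) c))
    (trans (sumOver-*ˡ xs c f) (ℚP.*-comm c _))

  sumOver-map : ∀ {B : Set} (xs : List B) (h : B → A) f → sumOver (L.map h xs) f ≡ sumOver xs (f ∘ h)
  sumOver-map []       h f = refl
  sumOver-map (x ∷ xs) h f = cong (f (h x) +_) (sumOver-map xs h f)

  sumOver-concatMap : ∀ {B : Set} (xs : List B) (h : B → List A) f →
    sumOver (L.concatMap h xs) f ≡ sumOver xs (λ x → sumOver (h x) f)
  sumOver-concatMap []       h f = refl
  sumOver-concatMap (x ∷ xs) h f = trans (sumOver-++ (h x) (L.concatMap h xs) f)
    (cong (sumOver (h x) f +_) (sumOver-concatMap xs h f))

sumUpTo : ℕ → (ℕ → ℚ) → ℚ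
sumUpTo zero    f = f 0
sumUpTo (suc y) f = f 0 + sumUpTo y (f ∘ suc)

sumUpTo-cong : ∀ y {f g} → (∀ b → f b ≡ g b) → sumUpTo y f ≡ sumUpTo y g
sumUpTo-cong zero    eq = eq 0
sumUpTo-cong (suc y) eq = cong₂ _+_ (eq 0) (sumUpTo-cong y (eq ∘ suc))

sumUpTo-+ : ∀ y f g → sumUpTo y (λ b → f b + g b) ≡ sumUpTo y f + sumUpTo y g
sumUpTo-+ zero    f g = refl
sumUpTo-+ (suc y) f g = trans (cong (f 0 + g 0 +_) (sumUpTo-+ y (f ∘ suc) (g ∘ suc))) (+-interchange (f 0) (g 0) _ _)

sumUpTo-*ˡ : ∀ y c f → sumUpTo y (λ b → c * f b) ≡ c * sumUpTo y f
sumUpTo-*ˡ zero    c f = refl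
sumUpTo-*ˡ (suc y) c f = trans (cong (c * f 0 +_) (sumUpTo-*ˡ y c (f ∘ suc))) (sym (ℚP.*-distribˡ-+ c (f 0) _))

sumUpTo-*ʳ : ∀ y c f → sumUpTo y (λ b → f b * c) ≡ sumUpTo y f * c
sumUpTo-*ʳ y c f = trans (sumUpTo-cong y (λ b → ℚP.*-comm (f b) c))
  (trans (sumUpTo-*ˡ y c f) (ℚP.*-comm c _))

sumUpTo-zero : ∀ y f → (∀ b → b ≤ y → f b ≡ 0ℚ) → sumUpTo y f ≡ 0ℚ
sumUpTo-zero zero    f eq = eq 0 z≤n
sumUpTo-zero (suc y) f eq = trans (cong₂ _+_ (eq 0 z≤n) (sumUpTo-zero y (f ∘ suc) (λ b b≤y → eq (suc b) (s≤s b≤y))))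
  (ℚP.+-identityˡ 0ℚ)

sumUpTo-single : ∀ y f c → c ≤ y → (∀ b → b ≤ y → b ≢ c → f b ≡ 0ℚ) → sumUpTo y f ≡ f c
sumUpTo-single zero    f zero    _ _ = refl
sumUpTo-single (suc y) f zero    _ eq = trans (cong (f 0 +_) (sumUpTo-zero y (f ∘ suc) (λ b b≤y → eq (suc b) (s≤s b≤y) λ ())))
  (ℚP.+-identityʳ _)
sumUpTo-single (suc y) f (suc c) (s≤s c≤y) eq = trans (cong₂ _+_ (eq 0 z≤n λ ())
  (sumUpTo-single y (f ∘ suc) c c≤y (λ b b≤y b≢c → eq (suc b) (s≤s b≤y) (b≢c ∘ ℕP.suc-injective))))
  (ℚP.+-identityˡ _)

sumUpTo-nonzero : ∀ y f → sumUpTo y f ≢ 0ℚ → ∃ λ b → b ≤ y × f b ≢ 0ℚ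
sumUpTo-nonzero zero    f ≢0 = 0 , z≤n , ≢0
sumUpTo-nonzero (suc y) f ≢0 with f 0 ℚP.≟ 0ℚ
... | no f0≢0 = 0 , z≤n , f0≢0
... | yes f0≡0 with sumUpTo-nonzero y (f ∘ suc) (λ rest≡0 → ≢0 (trans (cong₂ _+_ f0≡0 rest≡0) (ℚP.+-identityˡ 0ℚ)))
...   | b , b≤y , fb≢0 = suc b , s≤s b≤y , fb≢0

infix  4 _≤ᵛ_
infixl 6 _+ᵛ_ _∸ᵛ_

_≤ᵛ_ : ∀ {n} → Exp n → Exp n → Set
_≤ᵛ_ = Pointwise _≤_

_+ᵛ_ _∸ᵛ_ : ∀ {n} → Exp n → Exp n → Exp n
_+ᵛ_ = V.zipWith ℕ._+_
_∸ᵛ_ = V.zipWith _∸_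

0ᵛ : ∀ {n} → Exp n
0ᵛ {n} = replicate n 0

≤ᵛ-refl : ∀ {n} {α : Exp n} → α ≤ᵛ α
≤ᵛ-refl = Pointwise.refl ℕP.≤-refl

≤ᵛ-+ᵛ : ∀ {n} (α β : Exp n) → α ≤ᵛ α +ᵛ β
≤ᵛ-+ᵛ []      []      = []
≤ᵛ-+ᵛ (x ∷ α) (y ∷ β) = ℕP.m≤m+n x y ∷ ≤ᵛ-+ᵛ α β

+ᵛ-mono-≤ᵛ : ∀ {n} {α β γ δ : Exp n} → α ≤ᵛ γ → β ≤ᵛ δ → α +ᵛ β ≤ᵛ γ +ᵛ δ
+ᵛ-mono-≤ᵛ []       []       = []
+ᵛ-mono-≤ᵛ (p ∷ ps) (q ∷ qs) = ℕP.+-mono-≤ p q ∷ +ᵛ-mono-≤ᵛ ps qs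

+ᵛ-∸ᵛ : ∀ {n} {α β : Exp n} → α ≤ᵛ β → α +ᵛ (β ∸ᵛ α) ≡ β
+ᵛ-∸ᵛ []       = refl
+ᵛ-∸ᵛ (p ∷ ps) = cong₂ _∷_ (ℕP.m+[n∸m]≡n p) (+ᵛ-∸ᵛ ps)

+ᵛ-∸ᵛ-cancelˡ : ∀ {n} (α β : Exp n) → (α +ᵛ β) ∸ᵛ α ≡ β
+ᵛ-∸ᵛ-cancelˡ []      []      = refl
+ᵛ-∸ᵛ-cancelˡ (x ∷ α) (y ∷ β) = cong₂ _∷_ (ℕP.m+n∸m≡n x y) (+ᵛ-∸ᵛ-cancelˡ α β)

0ᵛ-+ᵛ : ∀ {n} (α : Exp n) → 0ᵛ +ᵛ α ≡ α
0ᵛ-+ᵛ []      = refl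
0ᵛ-+ᵛ (x ∷ α) = cong (x ∷_) (0ᵛ-+ᵛ α)

0ᵛ-∸ᵛ-0ᵛ : ∀ {n} → 0ᵛ {n} ∸ᵛ 0ᵛ ≡ 0ᵛ
0ᵛ-∸ᵛ-0ᵛ {zero}  = refl
0ᵛ-∸ᵛ-0ᵛ {suc n} = cong (0 ∷_) 0ᵛ-∸ᵛ-0ᵛ

tdeg-0ᵛ : ∀ n → tdeg (0ᵛ {n}) ≡ 0
tdeg-0ᵛ zero    = refl
tdeg-0ᵛ (suc n) = tdeg-0ᵛ n

tdeg≡0⇒≡0ᵛ : ∀ {n} (α : Exp n) → tdeg α ≡ 0 → α ≡ 0ᵛ
tdeg≡0⇒≡0ᵛ []          _  = refl
tdeg≡0⇒≡0ᵛ (zero ∷ α) eq = cong (0 ∷_) (tdeg≡0⇒≡0ᵛ α eq)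

tdeg-replicate : ∀ n x → tdeg (replicate n x) ≡ x ℕ.* n
tdeg-replicate zero    x = sym (ℕP.*-zeroʳ x)
tdeg-replicate (suc n) x = trans (cong (x ℕ.+_) (tdeg-replicate n x)) (sym (ℕP.*-suc x n))

tdeg-+ᵛ : ∀ {n} (α β : Exp n) → tdeg (α +ᵛ β) ≡ tdeg α ℕ.+ tdeg β
tdeg-+ᵛ []      []      = refl
tdeg-+ᵛ (x ∷ α) (y ∷ β) = trans (cong (x ℕ.+ y ℕ.+_) (tdeg-+ᵛ α β)) (ℕ-+-interchange x y (tdeg α) (tdeg β))

tdeg-∸ᵛ : ∀ {n} {α β : Exp n} → α ≤ᵛ β → tdeg α ℕ.+ tdeg (β ∸ᵛ α) ≡ tdeg β
tdeg-∸ᵛ {α = α} {β} α≤β = trans (sym (tdeg-+ᵛ α (β ∸ᵛ α))) (cong tdeg (+ᵛ-∸ᵛ α≤β))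

tdeg-mono-≤ᵛ : ∀ {n} {α β : Exp n} → α ≤ᵛ β → tdeg α ≤ tdeg β
tdeg-mono-≤ᵛ []       = z≤n
tdeg-mono-≤ᵛ (p ∷ ps) = ℕP.+-mono-≤ p (tdeg-mono-≤ᵛ ps)

≤ᵛ∧tdeg≥⇒≡ : ∀ {n} {α β : Exp n} → α ≤ᵛ β → tdeg β ≤ tdeg α → α ≡ β
≤ᵛ∧tdeg≥⇒≡ [] _ = refl
≤ᵛ∧tdeg≥⇒≡ {α = x ∷ α} (x≤y ∷ ps) deg≥ with ℕP.m≤n⇒m<n∨m≡n x≤y
... | inj₂ refl = cong (x ∷_) (≤ᵛ∧tdeg≥⇒≡ ps (ℕP.+-cancelˡ-≤ x _ _ deg≥))
... | inj₁ x<y  = ⊥-elim (ℕP.<⇒≱ (ℕP.+-mono-<-≤ x<y (tdeg-mono-≤ᵛ ps)) deg≥)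

sumBelow : ∀ {n} → Exp n → (Exp n → ℚ) → ℚ
sumBelow []      f = f []
sumBelow (y ∷ β) f = sumUpTo y λ b → sumBelow β (f ∘ (b ∷_))

sumBelow-cong : ∀ {n} (β : Exp n) {f g} → (∀ α → f α ≡ g α) → sumBelow β f ≡ sumBelow β g
sumBelow-cong []      eq = eq []
sumBelow-cong (y ∷ β) eq = sumUpTo-cong y λ b → sumBelow-cong β (eq ∘ (b ∷_))

sumBelow-+ : ∀ {n} (β : Exp n) f g → sumBelow β (λ α → f α + g α) ≡ sumBelow β f + sumBelow β g
sumBelow-+ []      f g = refl
sumBelow-+ (y ∷ β) f g = trans (sumUpTo-cong y λ b → sumBelow-+ β _ _) (sumUpTo-+ y _ _)

sumBelow-*ˡ : ∀ {n} (β : Exp n) c f → sumBelow β (λ α → c * f α) ≡ c * sumBelow β f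
sumBelow-*ˡ []      c f = refl
sumBelow-*ˡ (y ∷ β) c f = trans (sumUpTo-cong y λ b → sumBelow-*ˡ β c _) (sumUpTo-*ˡ y c _)

sumBelow-zero : ∀ {n} (β : Exp n) f → (∀ α → α ≤ᵛ β → f α ≡ 0ℚ) → sumBelow β f ≡ 0ℚ
sumBelow-zero []      f eq = eq [] []
sumBelow-zero (y ∷ β) f eq = sumUpTo-zero y _ λ b b≤y → sumBelow-zero β _ λ α α≤β → eq (b ∷ α) (b≤y ∷ α≤β)

sumBelow-single : ∀ {n} (β : Exp n) f γ → γ ≤ᵛ β → (∀ α → α ≤ᵛ β → α ≢ γ → f α ≡ 0ℚ) → sumBelow β f ≡ f γ
sumBelow-single []      f []      []         eq = refl
sumBelow-single (y ∷ β) f (c ∷ γ) (c≤y ∷ γ≤β) eq =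
  trans (sumUpTo-single y _ c c≤y λ b b≤y b≢c → sumBelow-zero β _ λ α α≤β → eq (b ∷ α) (b≤y ∷ α≤β) (b≢c ∘ cong V.head))
        (sumBelow-single β _ γ γ≤β λ α α≤β α≢γ → eq (c ∷ α) (c≤y ∷ α≤β) (α≢γ ∘ cong V.tail))

sumBelow-nonzero : ∀ {n} (β : Exp n) f → sumBelow β f ≢ 0ℚ → ∃ λ α → α ≤ᵛ β × f α ≢ 0ℚ
sumBelow-nonzero []      f ≢0 = [] , [] , ≢0
sumBelow-nonzero (y ∷ β) f ≢0 with sumUpTo-nonzero y _ ≢0
... | b , b≤y , ≢0′ with sumBelow-nonzero β _ ≢0′
...   | α , α≤β , fα≢0 = b ∷ α , b≤y ∷ α≤β , fα≢0

sumBelow-0ᵛ : ∀ {n} f → sumBelow (0ᵛ {n}) f ≡ f 0ᵛ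
sumBelow-0ᵛ {zero}  f = refl
sumBelow-0ᵛ {suc n} f = sumBelow-0ᵛ {n} (f ∘ (0 ∷_))

sumOver-sumBelow : ∀ {A : Set} {n} (xs : List A) (β : Exp n) (F : A → Exp n → ℚ) →
  sumOver xs (λ x → sumBelow β (F x)) ≡ sumBelow β (λ α → sumOver xs (λ x → F x α))
sumOver-sumBelow []       β F = sym (sumBelow-zero β _ λ _ _ → refl)
sumOver-sumBelow (x ∷ xs) β F = trans (cong (sumBelow β (F x) +_) (sumOver-sumBelow xs β F))
  (sym (sumBelow-+ β (F x) _))

-- Taylor coefficients

-- The coefficient of t^y in (t + a)^x; monomialShift is, definitionally, the product in coeffShift.
binomialShift : ℕ → ℕ → ℕ → ℕ
binomialShift a x y = (x C y) ℕ.* a ℕ.^ (x ∸ y)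

monomialShift : ∀ {n} → Vec ℕ n → Exp n → Exp n → ℕ
monomialShift a α β = V.foldr (λ _ → ℕ) ℕ._*_ 1
  (tabulate λ i → binomialShift (lookup a i) (lookup α i) (lookup β i))

binomialShift-suc-zero : ∀ a x → binomialShift a (suc x) 0 ≡ a ℕ.* binomialShift a x 0
binomialShift-suc-zero a x = trans (ℕP.*-identityˡ _) (cong (a ℕ.*_) (sym (ℕP.*-identityˡ _)))

binomialShift-pascal : ∀ a x y →
  binomialShift a (suc x) (suc y) ≡ binomialShift a x y ℕ.+ a ℕ.* binomialShift a x (suc y)
binomialShift-pascal a x y = begin
  (suc x C suc y) ℕ.* a ℕ.^ (x ∸ y)                  ≡⟨ cong (ℕ._* a ℕ.^ (x ∸ y)) (sym (ℕC.nCk+nC[k+1]≡[n+1]C[k+1] x y)) ⟩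
  (x C y ℕ.+ x C suc y) ℕ.* a ℕ.^ (x ∸ y)            ≡⟨ ℕP.*-distribʳ-+ (a ℕ.^ (x ∸ y)) (x C y) _ ⟩
  binomialShift a x y ℕ.+ (x C suc y) ℕ.* a ℕ.^ (x ∸ y) ≡⟨ cong (binomialShift a x y ℕ.+_) upper ⟩
  binomialShift a x y ℕ.+ a ℕ.* binomialShift a x (suc y) ∎
  where
  open ≡-Reasoning
  upper : (x C suc y) ℕ.* a ℕ.^ (x ∸ y) ≡ a ℕ.* binomialShift a x (suc y)
  upper with y ℕP.<? x
  ... | yes y<x = begin
    (x C suc y) ℕ.* a ℕ.^ (x ∸ y)                   ≡⟨ cong (λ e → (x C suc y) ℕ.* a ℕ.^ e) (ℕP.+-∸-assoc 1 y<x) ⟩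
    (x C suc y) ℕ.* (a ℕ.* a ℕ.^ (x ∸ suc y))       ≡⟨ CommSemigroupProperties.x∙yz≈y∙xz ℕP.*-commutativeSemigroup (x C suc y) a _ ⟩
    a ℕ.* binomialShift a x (suc y)                 ∎
  ... | no y≮x = begin
    (x C suc y) ℕ.* a ℕ.^ (x ∸ y)                   ≡⟨ cong (ℕ._* a ℕ.^ (x ∸ y)) C≡0 ⟩
    0                                               ≡⟨ sym (ℕP.*-zeroʳ a) ⟩
    a ℕ.* 0                                         ≡⟨ cong (λ c → a ℕ.* (c ℕ.* a ℕ.^ (x ∸ suc y))) (sym C≡0) ⟩
    a ℕ.* binomialShift a x (suc y)                 ∎
    where C≡0 = ℕC.k>n⇒nCk≡0 (s≤s (ℕP.≮⇒≥ y≮x))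

binomialShiftℚ : ℕ → ℕ → ℕ → ℚ
binomialShiftℚ a x y = ℕtoℚ (binomialShift a x y)

monomialShiftℚ : ∀ {n} → Vec ℕ n → Exp n → Exp n → ℚ
monomialShiftℚ a α β = ℕtoℚ (monomialShift a α β)

binomialShiftℚ-suc-zero : ∀ a x → binomialShiftℚ a (suc x) 0 ≡ ℕtoℚ a * binomialShiftℚ a x 0
binomialShiftℚ-suc-zero a x = trans (cong ℕtoℚ (binomialShift-suc-zero a x)) (ℕtoℚ-* a (binomialShift a x 0))

binomialShiftℚ-pascal : ∀ a x y →
  binomialShiftℚ a (suc x) (suc y) ≡ binomialShiftℚ a x y + ℕtoℚ a * binomialShiftℚ a x (suc y)
binomialShiftℚ-pascal a x y = trans (cong ℕtoℚ (binomialShift-pascal a x y))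
  (trans (ℕtoℚ-+ (binomialShift a x y) (a ℕ.* binomialShift a x (suc y)))
         (cong (binomialShiftℚ a x y +_) (ℕtoℚ-* a (binomialShift a x (suc y)))))

-- Vandermonde's identity, weighted by the powers of a.
binomialShiftℚ-+ : ∀ a x z y →
  binomialShiftℚ a (x ℕ.+ z) y ≡ sumUpTo y (λ b → binomialShiftℚ a x b * binomialShiftℚ a z (y ∸ b))
binomialShiftℚ-+ a zero z y = sym (trans (sumUpTo-single y _ 0 z≤n only-b≡0) (ℚP.*-identityˡ _))
  where
  only-b≡0 : ∀ b → b ≤ y → b ≢ 0 → binomialShiftℚ a 0 b * binomialShiftℚ a z (y ∸ b) ≡ 0ℚ
  only-b≡0 zero    _ b≢0 = ⊥-elim (b≢0 refl)
  only-b≡0 (suc b) _ _   = ℚP.*-zeroˡ (binomialShiftℚ a z (y ∸ suc b))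
binomialShiftℚ-+ a (suc x) z zero = begin
  binomialShiftℚ a (suc (x ℕ.+ z)) 0               ≡⟨ binomialShiftℚ-suc-zero a (x ℕ.+ z) ⟩
  ℕtoℚ a * binomialShiftℚ a (x ℕ.+ z) 0             ≡⟨ cong (ℕtoℚ a *_) (binomialShiftℚ-+ a x z 0) ⟩
  ℕtoℚ a * (binomialShiftℚ a x 0 * binomialShiftℚ a z 0) ≡⟨ sym (ℚP.*-assoc (ℕtoℚ a) _ _) ⟩
  ℕtoℚ a * binomialShiftℚ a x 0 * binomialShiftℚ a z 0  ≡⟨ cong (_* binomialShiftℚ a z 0) (sym (binomialShiftℚ-suc-zero a x)) ⟩
  binomialShiftℚ a (suc x) 0 * binomialShiftℚ a z 0     ∎
  where open ≡-Reasoning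
binomialShiftℚ-+ a (suc x) z (suc y) = begin
  binomialShiftℚ a (suc (x ℕ.+ z)) (suc y)
    ≡⟨ binomialShiftℚ-pascal a (x ℕ.+ z) y ⟩
  binomialShiftℚ a (x ℕ.+ z) y + A * binomialShiftℚ a (x ℕ.+ z) (suc y)
    ≡⟨ cong₂ (λ u v → u + A * v) (binomialShiftℚ-+ a x z y) (binomialShiftℚ-+ a x z (suc y)) ⟩
  S + A * (B x 0 * B z (suc y) + S′)
    ≡⟨ solve 5 (λ S A c w S′ → S :+ A :* (c :* w :+ S′) := A :* c :* w :+ (S :+ A :* S′)) refl S A (B x 0) (B z (suc y)) S′ ⟩
  A * B x 0 * B z (suc y) + (S + A * S′)
    ≡⟨ cong₂ (λ u v → u * B z (suc y) + v) (sym (binomialShiftℚ-suc-zero a x))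
             (trans (cong (S +_) (sym (sumUpTo-*ˡ y A _))) (sym (sumUpTo-+ y _ _))) ⟩
  B (suc x) 0 * B z (suc y) + sumUpTo y (λ b → B x b * B z (y ∸ b) + A * (B x (suc b) * B z (y ∸ b)))
    ≡⟨ cong (B (suc x) 0 * B z (suc y) +_) (sumUpTo-cong y pascal-term) ⟩
  sumUpTo (suc y) (λ b → B (suc x) b * B z (suc y ∸ b)) ∎
  where
  open ≡-Reasoning
  A = ℕtoℚ a
  B = binomialShiftℚ a
  S = sumUpTo y (λ b → B x b * B z (y ∸ b))
  S′ = sumUpTo y (λ b → B x (suc b) * B z (y ∸ b))
  pascal-term : ∀ b → B x b * B z (y ∸ b) + A * (B x (suc b) * B z (y ∸ b)) ≡ B (suc x) (suc b) * B z (y ∸ b)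
  pascal-term b = begin
    B x b * B z (y ∸ b) + A * (B x (suc b) * B z (y ∸ b)) ≡⟨ cong (B x b * B z (y ∸ b) +_) (sym (ℚP.*-assoc A _ _)) ⟩
    B x b * B z (y ∸ b) + A * B x (suc b) * B z (y ∸ b)   ≡⟨ sym (ℚP.*-distribʳ-+ (B z (y ∸ b)) (B x b) _) ⟩
    (B x b + A * B x (suc b)) * B z (y ∸ b)               ≡⟨ cong (_* B z (y ∸ b)) (sym (binomialShiftℚ-pascal a x b)) ⟩
    B (suc x) (suc b) * B z (y ∸ b)                       ∎

monomialShiftℚ-+ᵛ : ∀ {n} (a α γ β : Vec ℕ n) →
  monomialShiftℚ a (α +ᵛ γ) β ≡ sumBelow β (λ β₁ → monomialShiftℚ a α β₁ * monomialShiftℚ a γ (β ∸ᵛ β₁))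
monomialShiftℚ-+ᵛ []       []      []      []      = refl
monomialShiftℚ-+ᵛ (a₀ ∷ a) (x ∷ α) (z ∷ γ) (y ∷ β) = begin
  ℕtoℚ (binomialShift a₀ (x ℕ.+ z) y ℕ.* monomialShift a (α +ᵛ γ) β)
    ≡⟨ ℕtoℚ-* (binomialShift a₀ (x ℕ.+ z) y) (monomialShift a (α +ᵛ γ) β) ⟩
  binomialShiftℚ a₀ (x ℕ.+ z) y * monomialShiftℚ a (α +ᵛ γ) β
    ≡⟨ cong₂ _*_ (binomialShiftℚ-+ a₀ x z y) (monomialShiftℚ-+ᵛ a α γ β) ⟩
  sumUpTo y (λ b → B x b * B z (y ∸ b)) * sumBelow β (λ r → M α r * M γ (β ∸ᵛ r))
    ≡⟨ sym (sumUpTo-*ʳ y (sumBelow β (λ r → M α r * M γ (β ∸ᵛ r))) (λ b → B x b * B z (y ∸ b))) ⟩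
  sumUpTo y (λ b → B x b * B z (y ∸ b) * sumBelow β (λ r → M α r * M γ (β ∸ᵛ r)))
    ≡⟨ sumUpTo-cong y (λ b → sym (sumBelow-*ˡ β (B x b * B z (y ∸ b)) (λ r → M α r * M γ (β ∸ᵛ r)))) ⟩
  sumUpTo y (λ b → sumBelow β (λ r → B x b * B z (y ∸ b) * (M α r * M γ (β ∸ᵛ r))))
    ≡⟨ sumUpTo-cong y (λ b → sumBelow-cong β (λ r → trans (*-interchange (B x b) (B z (y ∸ b)) (M α r) (M γ (β ∸ᵛ r)))
         (sym (cong₂ _*_ (ℕtoℚ-* (binomialShift a₀ x b) (monomialShift a α r))
                         (ℕtoℚ-* (binomialShift a₀ z (y ∸ b)) (monomialShift a γ (β ∸ᵛ r))))))) ⟩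
  sumUpTo y (λ b → sumBelow β (λ r →
    monomialShiftℚ (a₀ ∷ a) (x ∷ α) (b ∷ r) * monomialShiftℚ (a₀ ∷ a) (z ∷ γ) (y ∸ b ∷ β ∸ᵛ r)))      ∎
  where
  open ≡-Reasoning
  B = binomialShiftℚ a₀
  M = monomialShiftℚ a

binomialShift-origin-≢ : ∀ {x y} → x ≢ y → binomialShift 0 x y ≡ 0
binomialShift-origin-≢ {x} {y} x≢y with ℕP.<-cmp x y
... | tri< x<y _ _ = cong (ℕ._* 0 ℕ.^ (x ∸ y)) (ℕC.k>n⇒nCk≡0 x<y)
... | tri≈ _ x≡y _ = ⊥-elim (x≢y x≡y)
... | tri> _ _ y<x = trans (cong (λ e → (x C y) ℕ.* 0 ℕ.^ e) (ℕP.+-∸-assoc 1 y<x)) (ℕP.*-zeroʳ (x C y))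

binomialShift-origin-refl : ∀ x → binomialShift 0 x x ≡ 1
binomialShift-origin-refl x = trans (cong (λ e → (x C x) ℕ.* 0 ℕ.^ e) (ℕP.n∸n≡0 x))
  (trans (ℕP.*-identityʳ (x C x)) (ℕC.nCn≡1 x))

monomialShift-origin-refl : ∀ {n} (α : Exp n) → monomialShift 0ᵛ α α ≡ 1
monomialShift-origin-refl []      = refl
monomialShift-origin-refl (x ∷ α) = cong₂ ℕ._*_ (binomialShift-origin-refl x) (monomialShift-origin-refl α)

monomialShift-origin-≢ : ∀ {n} {α β : Exp n} → α ≢ β → monomialShift 0ᵛ α β ≡ 0
monomialShift-origin-≢ {α = []} {[]} α≢β = ⊥-elim (α≢β refl)
monomialShift-origin-≢ {α = x ∷ α} {y ∷ β} α≢β with x ℕ.≟ y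
... | no x≢y    = cong (ℕ._* monomialShift 0ᵛ α β) (binomialShift-origin-≢ x≢y)
... | yes refl = trans (cong (binomialShift 0 x x ℕ.*_) (monomialShift-origin-≢ (α≢β ∘ cong (x ∷_))))
  (ℕP.*-zeroʳ (binomialShift 0 x x))

monomialShift-0ᵛ-0ᵛ : ∀ {n} (a : Vec ℕ n) → monomialShift a 0ᵛ 0ᵛ ≡ 1
monomialShift-0ᵛ-0ᵛ []       = refl
monomialShift-0ᵛ-0ᵛ (a₀ ∷ a) = trans (ℕP.+-identityʳ _) (monomialShift-0ᵛ-0ᵛ a)

monomialShift-0ᵛ-positive : ∀ {n} (a : Vec ℕ n) β → 0 < tdeg β → monomialShift a 0ᵛ β ≡ 0
monomialShift-0ᵛ-positive (a₀ ∷ a) (zero  ∷ β) deg>0 = trans (ℕP.+-identityʳ _) (monomialShift-0ᵛ-positive a β deg>0)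
monomialShift-0ᵛ-positive (a₀ ∷ a) (suc y ∷ β) _     = refl

infixl 6 _⊕_
infixl 7 _⊗_ _·_

_⊕_ : ∀ {n} → Poly n → Poly n → Poly n
_⊕_ = _++_

_·_ : ∀ {n} → ℚ → Poly n → Poly n
c · P = L.map (λ t → (c * proj₁ t , proj₂ t)) P

_⊗_ : ∀ {n} → Poly n → Poly n → Poly n
P ⊗ Q = L.concatMap (λ t → L.map (λ u → (proj₁ t * proj₁ u , proj₂ t +ᵛ proj₂ u)) Q) P

const : ∀ {n} → ℚ → Poly n
const c = (c , 0ᵛ) ∷ []

shiftTerm : ∀ {n} → Vec ℕ n → Exp n → ℚ × Exp n → ℚ
shiftTerm a β t = proj₁ t * monomialShiftℚ a (proj₂ t) β

coeffShift-⊕ : ∀ {n} (P Q : Poly n) a β → coeffShift (P ⊕ Q) a β ≡ coeffShift P a β + coeffShift Q a β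
coeffShift-⊕ P Q a β = sumOver-++ P Q (shiftTerm a β)

coeffShift-· : ∀ {n} c (P : Poly n) a β → coeffShift (c · P) a β ≡ c * coeffShift P a β
coeffShift-· c P a β = trans (sumOver-map P _ (shiftTerm a β))
  (trans (sumOver-cong P (λ t → ℚP.*-assoc c (proj₁ t) _)) (sumOver-*ˡ P c (shiftTerm a β)))

shiftTerm-⊗ : ∀ {n} (a β : Exp n) t u →
  shiftTerm a β (proj₁ t * proj₁ u , proj₂ t +ᵛ proj₂ u) ≡ sumBelow β (λ β₁ → shiftTerm a β₁ t * shiftTerm a (β ∸ᵛ β₁) u)
shiftTerm-⊗ a β (c , α) (d , γ) = begin
  c * d * monomialShiftℚ a (α +ᵛ γ) β
    ≡⟨ cong (c * d *_) (monomialShiftℚ-+ᵛ a α γ β) ⟩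
  c * d * sumBelow β (λ β₁ → monomialShiftℚ a α β₁ * monomialShiftℚ a γ (β ∸ᵛ β₁))
    ≡⟨ sym (sumBelow-*ˡ β (c * d) _) ⟩
  sumBelow β (λ β₁ → c * d * (monomialShiftℚ a α β₁ * monomialShiftℚ a γ (β ∸ᵛ β₁)))
    ≡⟨ sumBelow-cong β (λ β₁ → *-interchange c d _ _) ⟩
  sumBelow β (λ β₁ → c * monomialShiftℚ a α β₁ * (d * monomialShiftℚ a γ (β ∸ᵛ β₁))) ∎
  where open ≡-Reasoning

coeffShift-⊗ : ∀ {n} (P Q : Poly n) a β →
  coeffShift (P ⊗ Q) a β ≡ sumBelow β (λ β₁ → coeffShift P a β₁ * coeffShift Q a (β ∸ᵛ β₁))
coeffShift-⊗ P Q a β = begin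
  sumOver (P ⊗ Q) (shiftTerm a β)
    ≡⟨ sumOver-concatMap P _ (shiftTerm a β) ⟩
  sumOver P (λ t → sumOver (L.map (λ u → (proj₁ t * proj₁ u , proj₂ t +ᵛ proj₂ u)) Q) (shiftTerm a β))
    ≡⟨ sumOver-cong P (λ t → trans (sumOver-map Q _ (shiftTerm a β)) (sumOver-cong Q (shiftTerm-⊗ a β t))) ⟩
  sumOver P (λ t → sumOver Q (λ u → sumBelow β (λ β₁ → shiftTerm a β₁ t * shiftTerm a (β ∸ᵛ β₁) u)))
    ≡⟨ sumOver-cong P (λ t → sumOver-sumBelow Q β _) ⟩
  sumOver P (λ t → sumBelow β (λ β₁ → sumOver Q (λ u → shiftTerm a β₁ t * shiftTerm a (β ∸ᵛ β₁) u)))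
    ≡⟨ sumOver-sumBelow P β _ ⟩
  sumBelow β (λ β₁ → sumOver P (λ t → sumOver Q (λ u → shiftTerm a β₁ t * shiftTerm a (β ∸ᵛ β₁) u)))
    ≡⟨ sumBelow-cong β (λ β₁ → trans (sumOver-cong P (λ t → sumOver-*ˡ Q (shiftTerm a β₁ t) _))
                                      (sumOver-*ʳ P _ (shiftTerm a β₁))) ⟩
  sumBelow β (λ β₁ → coeffShift P a β₁ * coeffShift Q a (β ∸ᵛ β₁)) ∎
  where open ≡-Reasoning

coeffShift-const-0ᵛ : ∀ {n} c (a : Vec ℕ n) → coeffShift (const c) a 0ᵛ ≡ c
coeffShift-const-0ᵛ c a = trans (ℚP.+-identityʳ _)
  (trans (cong (λ k → c * ℕtoℚ k) (monomialShift-0ᵛ-0ᵛ a)) (ℚP.*-identityʳ c))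

coeffShift-const-positive : ∀ {n} c (a : Vec ℕ n) β → 0 < tdeg β → coeffShift (const c) a β ≡ 0ℚ
coeffShift-const-positive c a β deg>0 = trans (ℚP.+-identityʳ _)
  (trans (cong (λ k → c * ℕtoℚ k) (monomialShift-0ᵛ-positive a β deg>0)) (ℚP.*-zeroʳ c))

coeffShift-⊗-0ᵛ : ∀ {n} (P Q : Poly n) a → coeffShift (P ⊗ Q) a 0ᵛ ≡ coeffShift P a 0ᵛ * coeffShift Q a 0ᵛ
coeffShift-⊗-0ᵛ P Q a = trans (coeffShift-⊗ P Q a 0ᵛ)
  (trans (sumBelow-0ᵛ (λ β₁ → coeffShift P a β₁ * coeffShift Q a (0ᵛ ∸ᵛ β₁)))
         (cong (λ β → coeffShift P a 0ᵛ * coeffShift Q a β) 0ᵛ-∸ᵛ-0ᵛ))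

sumBelow-tdeg≡1 : ∀ {n} (β : Exp n) (f g : Exp n → ℚ) → tdeg β ≡ 1 →
  sumBelow β (λ β₁ → f β₁ * g (β ∸ᵛ β₁)) ≡ f 0ᵛ * g β + f β * g 0ᵛ
sumBelow-tdeg≡1 (zero ∷ β) f g deg≡1 = sumBelow-tdeg≡1 β (f ∘ (0 ∷_)) (g ∘ (0 ∷_)) deg≡1
sumBelow-tdeg≡1 {suc n} (suc zero ∷ β) f g deg≡1 rewrite tdeg≡0⇒≡0ᵛ β (ℕP.suc-injective deg≡1) =
  cong₂ _+_ (trans (sumBelow-0ᵛ {n} _) (cong (λ β′ → f 0ᵛ * g (1 ∷ β′)) 0ᵛ-∸ᵛ-0ᵛ))
            (trans (sumBelow-0ᵛ {n} _) (cong (λ β′ → f (1 ∷ 0ᵛ) * g (0 ∷ β′)) 0ᵛ-∸ᵛ-0ᵛ))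

coeffShift-⊗-tdeg≡1 : ∀ {n} (P Q : Poly n) a β → tdeg β ≡ 1 →
  coeffShift (P ⊗ Q) a β ≡ coeffShift P a 0ᵛ * coeffShift Q a β + coeffShift P a β * coeffShift Q a 0ᵛ
coeffShift-⊗-tdeg≡1 P Q a β deg≡1 = trans (coeffShift-⊗ P Q a β)
  (sumBelow-tdeg≡1 β (coeffShift P a) (coeffShift Q a) deg≡1)

coeff≡coeffShift-0ᵛ : ∀ {n} (P : Poly n) e → coeff P e ≡ coeffShift P 0ᵛ e
coeff≡coeffShift-0ᵛ []              e = refl
coeff≡coeffShift-0ᵛ ((c , α) ∷ P) e with α ≟ₑ e
... | yes refl = cong₂ _+_ (sym (trans (cong (λ k → c * ℕtoℚ k) (monomialShift-origin-refl α)) (ℚP.*-identityʳ c)))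
                           (coeff≡coeffShift-0ᵛ P e)
... | no α≢e   = cong₂ _+_ (sym (trans (cong (λ k → c * ℕtoℚ k) (monomialShift-origin-≢ α≢e)) (ℚP.*-zeroʳ c)))
                           (coeff≡coeffShift-0ᵛ P e)

MultAtLeast-⊕ : ∀ {n r} (P Q : Poly n) a → MultAtLeast r P a → MultAtLeast r Q a → MultAtLeast r (P ⊕ Q) a
MultAtLeast-⊕ P Q a multP multQ β deg<r = trans (coeffShift-⊕ P Q a β)
  (trans (cong₂ _+_ (multP β deg<r) (multQ β deg<r)) (ℚP.+-identityˡ 0ℚ))

MultAtLeast-· : ∀ {n r} c (P : Poly n) a → MultAtLeast r P a → MultAtLeast r (c · P) a
MultAtLeast-· c P a multP β deg<r = trans (coeffShift-· c P a β) (trans (cong (c *_) (multP β deg<r)) (ℚP.*-zeroʳ c))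

MultAtLeast-⊗ : ∀ {n r s} (P Q : Poly n) a → MultAtLeast r P a → MultAtLeast s Q a → MultAtLeast (r ℕ.+ s) (P ⊗ Q) a
MultAtLeast-⊗ {r = r} {s} P Q a multP multQ β deg<r+s =
  trans (coeffShift-⊗ P Q a β) (sumBelow-zero β (λ β₁ → coeffShift P a β₁ * coeffShift Q a (β ∸ᵛ β₁)) term≡0)
  where
  term≡0 : ∀ β₁ → β₁ ≤ᵛ β → coeffShift P a β₁ * coeffShift Q a (β ∸ᵛ β₁) ≡ 0ℚ
  term≡0 β₁ β₁≤β with r ℕP.≤? tdeg β₁
  ... | no r≰β₁ = trans (cong (_* coeffShift Q a (β ∸ᵛ β₁)) (multP β₁ (ℕP.≰⇒> r≰β₁))) (ℚP.*-zeroˡ (coeffShift Q a (β ∸ᵛ β₁)))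
  ... | yes r≤β₁ = trans (cong (coeffShift P a β₁ *_) (multQ (β ∸ᵛ β₁) rest<s)) (ℚP.*-zeroʳ (coeffShift P a β₁))
    where
    rest<s : tdeg (β ∸ᵛ β₁) < s
    rest<s = ℕP.+-cancelˡ-< (tdeg β₁) _ _ (ℕP.<-≤-trans (subst (_< r ℕ.+ s) (sym (tdeg-∸ᵛ β₁≤β)) deg<r+s)
                                                        (ℕP.+-monoˡ-≤ s r≤β₁))

MultAtLeast-mono : ∀ {n r s} (P : Poly n) a → s ≤ r → MultAtLeast r P a → MultAtLeast s P a
MultAtLeast-mono P a s≤r multP β deg<s = multP β (ℕP.<-≤-trans deg<s s≤r)

MultAtLeast-zero : ∀ {n} (P : Poly n) a → MultAtLeast 0 P a
MultAtLeast-zero P a β ()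

MultAtLeast-1 : ∀ {n} (P : Poly n) a → coeffShift P a 0ᵛ ≡ 0ℚ → MultAtLeast 1 P a
MultAtLeast-1 P a P[a]≡0 β deg<1 = trans (cong (coeffShift P a) (tdeg≡0⇒≡0ᵛ β (ℕP.n<1⇒n≡0 deg<1))) P[a]≡0

MultAtLeast-2 : ∀ {n} (P : Poly n) a → coeffShift P a 0ᵛ ≡ 0ℚ →
  (∀ β → tdeg β ≡ 1 → coeffShift P a β ≡ 0ℚ) → MultAtLeast 2 P a
MultAtLeast-2 P a P[a]≡0 dP[a]≡0 β deg<2 with tdeg β ℕ.≟ 0
... | yes deg≡0 = trans (cong (coeffShift P a) (tdeg≡0⇒≡0ᵛ β deg≡0)) P[a]≡0
... | no deg≢0  = dP[a]≡0 β (ℕP.≤-antisym (ℕP.≤-pred deg<2) (ℕP.n≢0⇒n>0 deg≢0))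

SupportedOn : ∀ {n} → (Exp n → Set) → Poly n → Set
SupportedOn A P = ∀ β → coeff P β ≢ 0ℚ → A β

DegreeAtMost : ∀ {n} → ℕ → Poly n → Set
DegreeAtMost d = SupportedOn (λ β → tdeg β ≤ d)

coeff-⊗ : ∀ {n} (P Q : Poly n) e → coeff (P ⊗ Q) e ≡ sumBelow e (λ β → coeff P β * coeff Q (e ∸ᵛ β))
coeff-⊗ P Q e = trans (coeff≡coeffShift-0ᵛ (P ⊗ Q) e) (trans (coeffShift-⊗ P Q 0ᵛ e)
  (sumBelow-cong e (λ β → sym (cong₂ _*_ (coeff≡coeffShift-0ᵛ P β) (coeff≡coeffShift-0ᵛ Q (e ∸ᵛ β))))))

coeff-⊕ : ∀ {n} (P Q : Poly n) e → coeff (P ⊕ Q) e ≡ coeff P e + coeff Q e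
coeff-⊕ P Q e = sumOver-++ P Q _

coeff-· : ∀ {n} c (P : Poly n) e → coeff (c · P) e ≡ c * coeff P e
coeff-· c P e = trans (coeff≡coeffShift-0ᵛ (c · P) e)
  (trans (coeffShift-· c P 0ᵛ e) (cong (c *_) (sym (coeff≡coeffShift-0ᵛ P e))))

module _ {n : ℕ} {A : Exp n → Set} where

  SupportedOn-⊕ : ∀ (P Q : Poly n) → SupportedOn A P → SupportedOn A Q → SupportedOn A (P ⊕ Q)
  SupportedOn-⊕ P Q suppP suppQ β coeff≢0 with coeff P β ℚP.≟ 0ℚ
  ... | no  ≢0 = suppP β ≢0
  ... | yes ≡0 = suppQ β λ ≡0′ → coeff≢0 (trans (coeff-⊕ P Q β) (trans (cong₂ _+_ ≡0 ≡0′) (ℚP.+-identityˡ 0ℚ)))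

  SupportedOn-· : ∀ c (P : Poly n) → SupportedOn A P → SupportedOn A (c · P)
  SupportedOn-· c P suppP β coeff≢0 = suppP β λ ≡0 → coeff≢0 (trans (coeff-· c P β) (trans (cong (c *_) ≡0) (ℚP.*-zeroʳ c)))

  SupportedOn-[] : SupportedOn A []
  SupportedOn-[] β 0≢0 = ⊥-elim (0≢0 refl)

  SupportedOn-mono : ∀ {B : Exp n → Set} (P : Poly n) → (∀ β → A β → B β) → SupportedOn A P → SupportedOn B P
  SupportedOn-mono P A⇒B suppP β coeff≢0 = A⇒B β (suppP β coeff≢0)

  SupportedOn-⊗ : ∀ {B : Exp n → Set} (P Q : Poly n) → SupportedOn A P → SupportedOn B Q →
    SupportedOn (λ β → ∃₂ λ β₁ β₂ → β ≡ β₁ +ᵛ β₂ × A β₁ × B β₂) (P ⊗ Q)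
  SupportedOn-⊗ {B} P Q suppP suppQ β coeff≢0 = split (sumBelow-nonzero β term (λ ≡0 → coeff≢0 (trans (coeff-⊗ P Q β) ≡0)))
    where
    term : Exp n → ℚ
    term β₁ = coeff P β₁ * coeff Q (β ∸ᵛ β₁)
    split : (∃ λ β₁ → β₁ ≤ᵛ β × term β₁ ≢ 0ℚ) → ∃₂ λ β₁ β₂ → β ≡ β₁ +ᵛ β₂ × A β₁ × B β₂
    split (β₁ , β₁≤β , term≢0) with *≢0⇒≢0 {coeff P β₁} {coeff Q (β ∸ᵛ β₁)} term≢0
    ... | ≢0 , ≢0′ = β₁ , β ∸ᵛ β₁ , sym (+ᵛ-∸ᵛ β₁≤β) , suppP β₁ ≢0 , suppQ (β ∸ᵛ β₁) ≢0′

  SupportedOn-All : ∀ (P : Poly n) → All (A ∘ proj₂) P → (∀ β → Dec (A β)) → SupportedOn A P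
  SupportedOn-All P all A? β coeff≢0 with A? β
  ... | yes Aβ = Aβ
  ... | no ¬Aβ = ⊥-elim (coeff≢0 (vanish P all))
    where
    vanish : ∀ Q → All (A ∘ proj₂) Q → coeff Q β ≡ 0ℚ
    vanish []            []            = refl
    vanish ((c , α) ∷ Q) (Aα ∷ allQ) with α ≟ₑ β
    ... | yes refl = ⊥-elim (¬Aβ Aα)
    ... | no _     = trans (ℚP.+-identityˡ _) (vanish Q allQ)

DegreeAtMost-mono : ∀ {n d d′} (P : Poly n) → d ≤ d′ → DegreeAtMost d P → DegreeAtMost d′ P
DegreeAtMost-mono P d≤d′ = SupportedOn-mono P (λ β deg≤d → ℕP.≤-trans deg≤d d≤d′)

DegreeAtMost-⊗ : ∀ {n d e} (P Q : Poly n) → DegreeAtMost d P → DegreeAtMost e Q → DegreeAtMost (d ℕ.+ e) (P ⊗ Q)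
DegreeAtMost-⊗ {d = d} {e} P Q degP degQ = SupportedOn-mono (P ⊗ Q)
  (λ { β (β₁ , β₂ , refl , deg₁ , deg₂) → subst (_≤ d ℕ.+ e) (sym (tdeg-+ᵛ β₁ β₂)) (ℕP.+-mono-≤ deg₁ deg₂) })
  (SupportedOn-⊗ P Q degP degQ)

DegreeAtMost-All : ∀ {n} d (P : Poly n) → All (λ t → tdeg (proj₂ t) ≤ d) P → DegreeAtMost d P
DegreeAtMost-All d P all = SupportedOn-All P all (λ β → tdeg β ℕP.≤? d)

DegreeAtMost-const : ∀ {n} c → DegreeAtMost {n} 0 (const c)
DegreeAtMost-const {n} c = DegreeAtMost-All 0 (const c) (ℕP.≤-reflexive (tdeg-0ᵛ n) ∷ [])

coeff-above-degree : ∀ {n d} (P : Poly n) e → DegreeAtMost d P → d < tdeg e → coeff P e ≡ 0ℚ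
coeff-above-degree P e degP d<e with coeff P e ℚP.≟ 0ℚ
... | yes ≡0 = ≡0
... | no ≢0  = ⊥-elim (ℕP.<⇒≱ d<e (degP e ≢0))

coeff-⊕-lower : ∀ {n d} (P Q : Poly n) γ → DegreeAtMost d Q → d < tdeg γ → coeff (P ⊕ Q) γ ≡ coeff P γ
coeff-⊕-lower P Q γ degQ d<γ = trans (coeff-⊕ P Q γ)
  (trans (cong (coeff P γ +_) (coeff-above-degree Q γ degQ d<γ)) (ℚP.+-identityʳ (coeff P γ)))

module TopCoefficient {n} (P Q : Poly n) (U : Exp n) (D : ℕ) (e : Exp n)
  (suppP : SupportedOn (_≤ᵛ U) P) (degQ : DegreeAtMost D Q) (deg-e : tdeg e ≡ tdeg U ℕ.+ D) where

  other-terms : ∀ β → β ≤ᵛ e → β ≢ U → coeff P β * coeff Q (e ∸ᵛ β) ≡ 0ℚ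
  other-terms β β≤e β≢U = *≡0⇐¬both≢0 λ ≢0 ≢0′ → β≢U (≤ᵛ∧tdeg≥⇒≡ (suppP β ≢0) (ℕP.+-cancelʳ-≤ D _ _ (begin
    tdeg U ℕ.+ D                  ≡⟨ sym deg-e ⟩
    tdeg e                        ≡⟨ sym (tdeg-∸ᵛ β≤e) ⟩
    tdeg β ℕ.+ tdeg (e ∸ᵛ β)      ≤⟨ ℕP.+-monoʳ-≤ (tdeg β) (degQ (e ∸ᵛ β) ≢0′) ⟩
    tdeg β ℕ.+ D                  ∎)))
    where open ℕP.≤-Reasoning

  coeff-⊗-top : U ≤ᵛ e → coeff (P ⊗ Q) e ≡ coeff P U * coeff Q (e ∸ᵛ U)
  coeff-⊗-top U≤e = trans (coeff-⊗ P Q e) (sumBelow-single e _ U U≤e other-terms)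

  coeff-⊗-top-≰ : ¬ U ≤ᵛ e → coeff (P ⊗ Q) e ≡ 0ℚ
  coeff-⊗-top-≰ U≰e = trans (coeff-⊗ P Q e) (sumBelow-zero e _ λ β β≤e → other-terms β β≤e λ { refl → U≰e β≤e })

taylor₁ : Poly 1 → ℕ → ℕ → ℚ
taylor₁ p x b = coeffShift p (x ∷ []) (b ∷ [])

coeff₁≡taylor₁ : ∀ (p : Poly 1) b → coeff p (b ∷ []) ≡ taylor₁ p 0 b
coeff₁≡taylor₁ p b = coeff≡coeffShift-0ᵛ p (b ∷ [])

record Jet₂ (p : Poly 1) (a₀ a₁ a₂ : ℚ) : Set where
  field
    order₀ : taylor₁ p 0 0 ≡ a₀
    order₁ : taylor₁ p 0 1 ≡ a₁
    order₂ : taylor₁ p 0 2 ≡ a₂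
open Jet₂

Jet₂-⊗ : ∀ {p q a₀ a₁ a₂ b₀ b₁ b₂} → Jet₂ p a₀ a₁ a₂ → Jet₂ q b₀ b₁ b₂ →
  Jet₂ (p ⊗ q) (a₀ * b₀) (a₀ * b₁ + a₁ * b₀) (a₀ * b₂ + (a₁ * b₁ + a₂ * b₀))
Jet₂-⊗ {p} {q} jp jq = record
  { order₀ = trans (coeffShift-⊗ p q (0 ∷ []) (0 ∷ [])) (cong₂ _*_ (order₀ jp) (order₀ jq))
  ; order₁ = trans (coeffShift-⊗ p q (0 ∷ []) (1 ∷ []))
                   (cong₂ _+_ (cong₂ _*_ (order₀ jp) (order₁ jq)) (cong₂ _*_ (order₁ jp) (order₀ jq)))
  ; order₂ = trans (coeffShift-⊗ p q (0 ∷ []) (2 ∷ []))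
                   (cong₂ _+_ (cong₂ _*_ (order₀ jp) (order₂ jq))
                              (cong₂ _+_ (cong₂ _*_ (order₁ jp) (order₁ jq)) (cong₂ _*_ (order₂ jp) (order₀ jq))))
  }

Jet₂-cong : ∀ {p a₀ a₁ a₂ b₀ b₁ b₂} → a₀ ≡ b₀ → a₁ ≡ b₁ → a₂ ≡ b₂ → Jet₂ p a₀ a₁ a₂ → Jet₂ p b₀ b₁ b₂
Jet₂-cong refl refl refl jet = jet

affine : ℚ → Poly 1
affine c = (1ℚ , 0 ∷ []) ∷ (c , 1 ∷ []) ∷ []

quadratic : ℚ → ℚ → Poly 1
quadratic c d = (1ℚ , 0 ∷ []) ∷ (c , 1 ∷ []) ∷ (d , 2 ∷ []) ∷ []

affine-value : ∀ c x → taylor₁ (affine c) x 0 ≡ 1ℚ + c * ℕtoℚ x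
affine-value c x = cong₂ _+_ (ℚP.*-identityˡ 1ℚ) (trans (ℚP.+-identityʳ _) (cong (λ k → c * ℕtoℚ k) x¹≡x))
  where
  x¹≡x : (1 C 0) ℕ.* x ℕ.^ 1 ℕ.* 1 ≡ x
  x¹≡x = trans (ℕP.*-identityʳ _) (trans (ℕP.+-identityʳ _) (ℕP.*-identityʳ x))

affine-jet : ∀ c → Jet₂ (affine c) 1ℚ c 0ℚ
affine-jet c = record
  { order₀ = solve 1 (λ c → con 1ℚ :* con 1ℚ :+ (c :* con 0ℚ :+ con 0ℚ) := con 1ℚ) refl c
  ; order₁ = solve 1 (λ c → con 1ℚ :* con 0ℚ :+ (c :* con 1ℚ :+ con 0ℚ) := c) refl c
  ; order₂ = solve 1 (λ c → con 1ℚ :* con 0ℚ :+ (c :* con 0ℚ :+ con 0ℚ) := con 0ℚ) refl c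
  }

quadratic-jet : ∀ c d → Jet₂ (quadratic c d) 1ℚ c d
quadratic-jet c d = record
  { order₀ = solve 2 (λ c d → con 1ℚ :* con 1ℚ :+ (c :* con 0ℚ :+ (d :* con 0ℚ :+ con 0ℚ)) := con 1ℚ) refl c d
  ; order₁ = solve 2 (λ c d → con 1ℚ :* con 0ℚ :+ (c :* con 1ℚ :+ (d :* con 0ℚ :+ con 0ℚ)) := c) refl c d
  ; order₂ = solve 2 (λ c d → con 1ℚ :* con 0ℚ :+ (c :* con 0ℚ :+ (d :* con 1ℚ :+ con 0ℚ)) := d) refl c d
  }

affine-degree : ∀ c → DegreeAtMost 1 (affine c)
affine-degree c = DegreeAtMost-All 1 (affine c) (z≤n ∷ s≤s z≤n ∷ [])

quadratic-degree : ∀ c d → DegreeAtMost 2 (quadratic c d)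
quadratic-degree c d = DegreeAtMost-All 2 (quadratic c d) (z≤n ∷ s≤s z≤n ∷ s≤s (s≤s z≤n) ∷ [])

taylor₁-⊗-value : ∀ (p q : Poly 1) x → taylor₁ (p ⊗ q) x 0 ≡ taylor₁ p x 0 * taylor₁ q x 0
taylor₁-⊗-value p q x = coeffShift-⊗ p q (x ∷ []) (0 ∷ [])

coeff₁-⊗-top : ∀ (p q : Poly 1) d e → DegreeAtMost d p → DegreeAtMost e q →
  coeff (p ⊗ q) (d ℕ.+ e ∷ []) ≡ coeff p (d ∷ []) * coeff q (e ∷ [])
coeff₁-⊗-top p q d e deg-p deg-q =
  trans (TopCoefficient.coeff-⊗-top p q (d ∷ []) e (d ℕ.+ e ∷ []) below-d deg-q deg≡ (ℕP.m≤m+n d e ∷ []))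
        (cong (λ k → coeff p (d ∷ []) * coeff q (k ∷ [])) (ℕP.m+n∸m≡n d e))
  where
  below-d : SupportedOn (_≤ᵛ d ∷ []) p
  below-d (x ∷ []) ≢0 = subst (_≤ d) (ℕP.+-identityʳ x) (deg-p (x ∷ []) ≢0) ∷ []
  deg≡ : tdeg (d ℕ.+ e ∷ []) ≡ tdeg (d ∷ []) ℕ.+ e
  deg≡ = trans (ℕP.+-identityʳ _) (cong (ℕ._+ e) (sym (ℕP.+-identityʳ d)))

-- Opaque, so that the type checker never normalises the reciprocal.
opaque
  inverseSuc : ℕ → ℚ
  inverseSuc j = (ℚ.1/ ℕtoℚ (suc j)) {{ℕtoℚ-suc-nonZero j}}

  inverseSuc-inverse : ∀ j → ℕtoℚ (suc j) * inverseSuc j ≡ 1ℚ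
  inverseSuc-inverse j = ℚP.*-inverseʳ (ℕtoℚ (suc j)) {{ℕtoℚ-suc-nonZero j}}

  inverseSuc-positive : ∀ j → ℚ.Positive (inverseSuc j)
  inverseSuc-positive j = ℚP.1/pos⇒pos (ℕtoℚ (suc j)) {{ℕtoℚ-suc-positive j}}

slope : ℕ → ℚ
slope j = - inverseSuc j

slope-negative : ∀ j → ℚ.Negative (slope j)
slope-negative j = ℚP.neg-pos {inverseSuc j} (inverseSuc-positive j)

slope≢0 : ∀ j → slope j ≢ 0ℚ
slope≢0 j slope≡0 = ℚP.<-irrefl slope≡0 (ℚP.negative⁻¹ (slope j) {{slope-negative j}})

lagrange₀ : ℕ → Poly 1
lagrange₀ zero    = const 1ℚ
lagrange₀ (suc J) = lagrange₀ J ⊗ affine (slope J)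

lagrange₀-at-0 : ∀ J → taylor₁ (lagrange₀ J) 0 0 ≡ 1ℚ
lagrange₀-at-0 zero    = refl
lagrange₀-at-0 (suc J) = trans (taylor₁-⊗-value (lagrange₀ J) (affine (slope J)) 0)
  (trans (cong₂ _*_ (lagrange₀-at-0 J) (order₀ (affine-jet (slope J)))) (ℚP.*-identityˡ 1ℚ))

lagrange₀-root : ∀ J x → 1 ≤ x → x ≤ J → taylor₁ (lagrange₀ J) x 0 ≡ 0ℚ
lagrange₀-root zero    x 1≤x x≤0 = ⊥-elim (ℕP.<⇒≱ 1≤x x≤0)
lagrange₀-root (suc J) x 1≤x x≤1+J = trans (taylor₁-⊗-value (lagrange₀ J) (affine (slope J)) x) (*≡0⇐¬both≢0 root)
  where
  root : taylor₁ (lagrange₀ J) x 0 ≢ 0ℚ → taylor₁ (affine (slope J)) x 0 ≢ 0ℚ → ⊥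
  root ≢0 ≢0′ with x ℕ.≟ suc J
  ... | no x≢1+J = ≢0 (lagrange₀-root J x 1≤x (ℕP.≤-pred (ℕP.≤∧≢⇒< x≤1+J x≢1+J)))
  ... | yes refl = ≢0′ (begin
    taylor₁ (affine (slope J)) (suc J) 0 ≡⟨ affine-value (slope J) (suc J) ⟩
    1ℚ + - inverseSuc J * ℕtoℚ (suc J)   ≡⟨ cong (1ℚ +_) (sym (ℚP.neg-distribˡ-* (inverseSuc J) (ℕtoℚ (suc J)))) ⟩
    1ℚ + - (inverseSuc J * ℕtoℚ (suc J)) ≡⟨ cong (λ y → 1ℚ + - y) (trans (ℚP.*-comm (inverseSuc J) _) (inverseSuc-inverse J)) ⟩
    1ℚ + - 1ℚ                            ≡⟨ ℚP.+-inverseʳ 1ℚ ⟩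
    0ℚ                                   ∎)
    where open ≡-Reasoning

lagrange₀-degree : ∀ J → DegreeAtMost J (lagrange₀ J)
lagrange₀-degree zero    = DegreeAtMost-const 1ℚ
lagrange₀-degree (suc J) = subst (λ d → DegreeAtMost d (lagrange₀ (suc J))) (ℕP.+-comm J 1)
  (DegreeAtMost-⊗ (lagrange₀ J) (affine (slope J)) (lagrange₀-degree J) (affine-degree (slope J)))

lagrange₀-lc : ℕ → ℚ
lagrange₀-lc zero    = 1ℚ
lagrange₀-lc (suc J) = lagrange₀-lc J * slope J

lagrange₀-lc≢0 : ∀ J → lagrange₀-lc J ≢ 0ℚ
lagrange₀-lc≢0 zero    ()
lagrange₀-lc≢0 (suc J) = *-≢0 (lagrange₀-lc≢0 J) (slope≢0 J)

coeff-lagrange₀-top : ∀ J → coeff (lagrange₀ J) (J ∷ []) ≡ lagrange₀-lc J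
coeff-lagrange₀-top zero    = refl
coeff-lagrange₀-top (suc J) = begin
  coeff (lagrange₀ (suc J)) (suc J ∷ [])
    ≡⟨ cong (λ d → coeff (lagrange₀ (suc J)) (d ∷ [])) (ℕP.+-comm 1 J) ⟩
  coeff (lagrange₀ (suc J)) (J ℕ.+ 1 ∷ [])
    ≡⟨ coeff₁-⊗-top (lagrange₀ J) (affine (slope J)) J 1 (lagrange₀-degree J) (affine-degree (slope J)) ⟩
  coeff (lagrange₀ J) (J ∷ []) * coeff (affine (slope J)) (1 ∷ [])
    ≡⟨ cong₂ _*_ (coeff-lagrange₀-top J) (trans (coeff₁≡taylor₁ (affine (slope J)) 1) (order₁ (affine-jet (slope J)))) ⟩
  lagrange₀-lc J * slope J
    ∎
  where open ≡-Reasoning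

c₁ c₂ : ℕ → ℚ
c₁ J = taylor₁ (lagrange₀ J) 0 1
c₂ J = taylor₁ (lagrange₀ J) 0 2

lagrange₀-jet : ∀ J → Jet₂ (lagrange₀ J) 1ℚ (c₁ J) (c₂ J)
lagrange₀-jet J = record { order₀ = lagrange₀-at-0 J ; order₁ = refl ; order₂ = refl }

c₁-suc : ∀ J → c₁ (suc J) ≡ slope J + c₁ J
c₁-suc J = trans (order₁ (Jet₂-⊗ (lagrange₀-jet J) (affine-jet (slope J))))
  (cong₂ _+_ (ℚP.*-identityˡ (slope J)) (ℚP.*-identityʳ (c₁ J)))

c₂-suc : ∀ J → c₂ (suc J) ≡ c₁ J * slope J + c₂ J
c₂-suc J = trans (order₂ (Jet₂-⊗ (lagrange₀-jet J) (affine-jet (slope J))))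
  (solve 3 (λ s g h → con 1ℚ :* con 0ℚ :+ (g :* s :+ h :* con 1ℚ) := g :* s :+ h) refl (slope J) (c₁ J) (c₂ J))

c₁-nonPositive : ∀ J → ℚ.NonPositive (c₁ J)
c₁-negative : ∀ J → ℚ.Negative (c₁ (suc J))
c₁-nonPositive zero    = _
c₁-nonPositive (suc J) = ℚP.neg⇒nonPos (c₁ (suc J)) {{c₁-negative J}}
c₁-negative J = subst ℚ.Negative (sym (c₁-suc J))
  (ℚP.neg+nonPos⇒neg (slope J) {{slope-negative J}} (c₁ J) {{c₁-nonPositive J}})

-- 3 δ J is the coefficient of x² in (lagrange₀ J)⁻³.
δ : ℕ → ℚ
δ J = c₁ J * c₁ J + c₁ J * c₁ J + - c₂ J

δ-suc : ∀ J → δ (suc J) ≡ δ J + (c₁ J * slope J + c₁ J * slope J + c₁ J * slope J) + (slope J * slope J + slope J * slope J)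
δ-suc J = trans (cong₂ (λ u v → u * u + u * u + - v) (c₁-suc J) (c₂-suc J))
  (solve 3 (λ s g h → (s :+ g) :* (s :+ g) :+ (s :+ g) :* (s :+ g) :+ (:- (g :* s :+ h)) :=
                      (g :* g :+ g :* g :+ (:- h)) :+ (g :* s :+ g :* s :+ g :* s) :+ (s :* s :+ s :* s))
         refl (slope J) (c₁ J) (c₂ J))

δ-nonNegative : ∀ J → ℚ.NonNegative (δ J)
δ-positive : ∀ J → ℚ.Positive (δ (suc J))
δ-nonNegative zero    = _
δ-nonNegative (suc J) = ℚP.pos⇒nonNeg (δ (suc J)) {{δ-positive J}}
δ-positive J = subst ℚ.Positive (sym (δ-suc J))
  (ℚP.nonNeg+pos⇒pos (δ J + c₁s+c₁s+c₁s) {{ℚP.nonNeg+nonNeg⇒nonNeg (δ J) {{δ-nonNegative J}} c₁s+c₁s+c₁s {{three-c₁s}}}}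
                     (s² + s²) {{ℚP.pos+pos⇒pos s² {{s²-positive}} s² {{s²-positive}}}})
  where
  c₁s = c₁ J * slope J
  c₁s+c₁s+c₁s = c₁s + c₁s + c₁s
  s² = slope J * slope J
  c₁s-nonNegative : ℚ.NonNegative c₁s
  c₁s-nonNegative = ℚP.nonPos*nonPos⇒nonPos (c₁ J) {{c₁-nonPositive J}} (slope J) {{ℚP.neg⇒nonPos (slope J) {{slope-negative J}}}}
  three-c₁s : ℚ.NonNegative c₁s+c₁s+c₁s
  three-c₁s = ℚP.nonNeg+nonNeg⇒nonNeg (c₁s + c₁s) {{ℚP.nonNeg+nonNeg⇒nonNeg c₁s {{c₁s-nonNegative}} c₁s {{c₁s-nonNegative}}}}
                                      c₁s {{c₁s-nonNegative}}
  s²-positive : ℚ.Positive s²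
  s²-positive = ℚP.neg*neg⇒pos (slope J) {{slope-negative J}} (slope J) {{slope-negative J}}

-- Indicators of x ≠ 0 on {0, …, m}

nonzeroIndicator : ℕ → ℕ
nonzeroIndicator zero    = 0
nonzeroIndicator (suc _) = 1

record FlatIndicator (r m : ℕ) (e : Poly 1) : Set where
  field
    value      : ∀ x → x ≤ m → taylor₁ e x 0 ≡ ℕtoℚ (nonzeroIndicator x)
    derivative : ∀ x → x ≤ m → ∀ b → 0 < b → b < r → taylor₁ e x b ≡ 0ℚ

complement : Poly 1 → Poly 1
complement W = const 1ℚ ⊕ (- 1ℚ) · W

taylor₁-complement : ∀ W x b → taylor₁ (complement W) x b ≡ taylor₁ (const 1ℚ) x b + - 1ℚ * taylor₁ W x b
taylor₁-complement W x b = trans (coeffShift-⊕ (const 1ℚ) ((- 1ℚ) · W) (x ∷ []) (b ∷ []))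
  (cong (taylor₁ (const 1ℚ) x b +_) (coeffShift-· (- 1ℚ) W (x ∷ []) (b ∷ [])))

taylor₁-complement-positive : ∀ W x b → 0 < b → taylor₁ (complement W) x b ≡ - 1ℚ * taylor₁ W x b
taylor₁-complement-positive W x b 0<b = trans (taylor₁-complement W x b)
  (trans (cong (_+ - 1ℚ * taylor₁ W x b) (coeffShift-const-positive 1ℚ (x ∷ []) (b ∷ []) (subst (0 <_) (sym (ℕP.+-identityʳ b)) 0<b)))
         (ℚP.+-identityˡ _))

complement-flatIndicator : ∀ r m W → 1 ≤ r → (∀ x → 1 ≤ x → x ≤ m → MultAtLeast r W (x ∷ [])) →
  taylor₁ W 0 0 ≡ 1ℚ → (∀ b → 0 < b → b < r → taylor₁ W 0 b ≡ 0ℚ) → FlatIndicator r m (complement W)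
complement-flatIndicator r m W 1≤r multW W[0]≡1 dW[0]≡0 = record { value = value ; derivative = derivatives }
  where
  W-derivative≡0 : ∀ x → x ≤ m → ∀ b → 0 < b → b < r → taylor₁ W x b ≡ 0ℚ
  W-derivative≡0 zero    _   b 0<b b<r = dW[0]≡0 b 0<b b<r
  W-derivative≡0 (suc x) x≤m b 0<b b<r = multW (suc x) (s≤s z≤n) x≤m (b ∷ []) (subst (_< r) (sym (ℕP.+-identityʳ b)) b<r)
  value : ∀ x → x ≤ m → taylor₁ (complement W) x 0 ≡ ℕtoℚ (nonzeroIndicator x)
  value zero    _   = trans (taylor₁-complement W 0 0) (cong (λ w → 1ℚ + - 1ℚ * w) W[0]≡1)
  value (suc x) x≤m = trans (taylor₁-complement W (suc x) 0)
    (cong (λ w → 1ℚ + - 1ℚ * w) (multW (suc x) (s≤s z≤n) x≤m (0 ∷ []) (ℕP.≤-trans 1≤r ℕP.≤-refl)))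
  derivatives : ∀ x → x ≤ m → ∀ b → 0 < b → b < r → taylor₁ (complement W) x b ≡ 0ℚ
  derivatives x x≤m b 0<b b<r = trans (taylor₁-complement-positive W x b 0<b)
    (trans (cong (- 1ℚ *_) (W-derivative≡0 x x≤m b 0<b b<r)) (ℚP.*-zeroʳ (- 1ℚ)))

complement-degree : ∀ {d} W → DegreeAtMost d W → DegreeAtMost d (complement W)
complement-degree W degW = SupportedOn-⊕ (const 1ℚ) ((- 1ℚ) · W)
  (DegreeAtMost-mono (const 1ℚ) z≤n (DegreeAtMost-const 1ℚ)) (SupportedOn-· (- 1ℚ) W degW)

complement-leading : ∀ W d → 0 < d → coeff W (d ∷ []) ≢ 0ℚ → coeff (complement W) (d ∷ []) ≢ 0ℚ
complement-leading W d 0<d lc≢0 lc′≡0 = *-≢0 {x = - 1ℚ} (λ ()) lc≢0 (begin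
  - 1ℚ * coeff W (d ∷ [])                ≡⟨ cong (- 1ℚ *_) (coeff₁≡taylor₁ W d) ⟩
  - 1ℚ * taylor₁ W 0 d                   ≡⟨ sym (taylor₁-complement-positive W 0 d 0<d) ⟩
  taylor₁ (complement W) 0 d             ≡⟨ sym (coeff₁≡taylor₁ (complement W) d) ⟩
  coeff (complement W) (d ∷ [])          ≡⟨ lc′≡0 ⟩
  0ℚ                                     ∎)
  where open ≡-Reasoning

record Indicator (r m : ℕ) : Set where
  field
    poly      : Poly 1
    isFlat    : FlatIndicator r m poly
    degree    : DegreeAtMost (suc m ℕ.* r ∸ 1) poly
    top≢0     : coeff poly (suc m ℕ.* r ∸ 1 ∷ []) ≢ 0ℚ

-- In poly = 1 − T^r q the leading coefficient of q is −2c₁ > 0 for r = 2 and 3δ > 0 for r = 3.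
module _ (m′ : ℕ) where
  private
    m = suc m′
    T = lagrange₀ m
    γ₁ = c₁ m
    γ₂ = c₂ m
    L≢0 = lagrange₀-lc≢0 m

    T-mult : ∀ x → 1 ≤ x → x ≤ m → MultAtLeast 1 T (x ∷ [])
    T-mult x 1≤x x≤m = MultAtLeast-1 T (x ∷ []) (lagrange₀-root m x 1≤x x≤m)

    T-leading : coeff T (m ∷ []) ≢ 0ℚ
    T-leading = subst (_≢ 0ℚ) (sym (coeff-lagrange₀-top m)) L≢0

    T⊗T-degree : DegreeAtMost (m ℕ.+ m) (T ⊗ T)
    T⊗T-degree = DegreeAtMost-⊗ T T (lagrange₀-degree m) (lagrange₀-degree m)

    T⊗T⊗T-degree : DegreeAtMost (m ℕ.+ m ℕ.+ m) (T ⊗ T ⊗ T)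
    T⊗T⊗T-degree = DegreeAtMost-⊗ (T ⊗ T) T T⊗T-degree (lagrange₀-degree m)

    T⊗T-leading : coeff (T ⊗ T) (m ℕ.+ m ∷ []) ≢ 0ℚ
    T⊗T-leading = subst (_≢ 0ℚ) (sym (coeff₁-⊗-top T T m m (lagrange₀-degree m) (lagrange₀-degree m)))
      (*-≢0 T-leading T-leading)

    T⊗T⊗T-leading : coeff (T ⊗ T ⊗ T) (m ℕ.+ m ℕ.+ m ∷ []) ≢ 0ℚ
    T⊗T⊗T-leading = subst (_≢ 0ℚ) (sym (coeff₁-⊗-top (T ⊗ T) T (m ℕ.+ m) m T⊗T-degree (lagrange₀-degree m)))
      (*-≢0 T⊗T-leading T-leading)

  indicator₁ : Indicator 1 m
  indicator₁ = record
    { poly      = complement T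
    ; isFlat    = complement-flatIndicator 1 m T ℕP.≤-refl T-mult (lagrange₀-at-0 m) (λ b 0<b b<1 → ⊥-elim (ℕP.<⇒≱ 0<b (ℕP.≤-pred b<1)))
    ; degree    = subst (λ d → DegreeAtMost d (complement T)) (sym (ℕP.*-identityʳ m)) (complement-degree T (lagrange₀-degree m))
    ; top≢0     = subst (λ d → coeff (complement T) (d ∷ []) ≢ 0ℚ) (sym (ℕP.*-identityʳ m)) (complement-leading T m (s≤s z≤n) T-leading)
    }

  indicator₂ : Indicator 2 m
  indicator₂ = record
    { poly      = complement W
    ; isFlat    = complement-flatIndicator 2 m W (s≤s z≤n) W-mult (order₀ W-jet) W-derivative
    ; degree    = subst (λ d → DegreeAtMost d (complement W)) D≡ (complement-degree W W-degree)
    ; top≢0     = subst (λ d → coeff (complement W) (d ∷ []) ≢ 0ℚ) D≡ (complement-leading W (m ℕ.+ m ℕ.+ 1) (s≤s z≤n) W-leading)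
    }
    where
    c = - (γ₁ + γ₁)
    W = T ⊗ T ⊗ affine c
    W-mult : ∀ x → 1 ≤ x → x ≤ m → MultAtLeast 2 W (x ∷ [])
    W-mult x 1≤x x≤m = MultAtLeast-⊗ (T ⊗ T) (affine c) (x ∷ [])
      (MultAtLeast-⊗ T T (x ∷ []) (T-mult x 1≤x x≤m) (T-mult x 1≤x x≤m)) (MultAtLeast-zero (affine c) (x ∷ []))
    W-jet : Jet₂ W 1ℚ 0ℚ (1ℚ * 1ℚ * 0ℚ + ((1ℚ * γ₁ + γ₁ * 1ℚ) * c + (1ℚ * γ₂ + (γ₁ * γ₁ + γ₂ * 1ℚ)) * 1ℚ))
    W-jet = Jet₂-cong (solve 0 (con 1ℚ :* con 1ℚ :* con 1ℚ := con 1ℚ) refl)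
                      (solve 1 (λ g → con 1ℚ :* con 1ℚ :* (:- (g :+ g)) :+ (con 1ℚ :* g :+ g :* con 1ℚ) :* con 1ℚ := con 0ℚ) refl γ₁)
                      refl
                      (Jet₂-⊗ (Jet₂-⊗ (lagrange₀-jet m) (lagrange₀-jet m)) (affine-jet c))
    W-derivative : ∀ b → 0 < b → b < 2 → taylor₁ W 0 b ≡ 0ℚ
    W-derivative 1 _ _ = order₁ W-jet
    W-derivative (suc (suc _)) _ (s≤s (s≤s ()))
    W-degree : DegreeAtMost (m ℕ.+ m ℕ.+ 1) W
    W-degree = DegreeAtMost-⊗ (T ⊗ T) (affine c) T⊗T-degree (affine-degree c)
    c≢0 : c ≢ 0ℚ
    c≢0 c≡0 = ℚP.<-irrefl (ℚP.neg-injective c≡0) (ℚP.negative⁻¹ (γ₁ + γ₁) {{ℚP.neg+nonPos⇒neg γ₁ {{c₁-negative m′}} γ₁ {{c₁-nonPositive m}}}})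
    W-leading : coeff W (m ℕ.+ m ℕ.+ 1 ∷ []) ≢ 0ℚ
    W-leading = subst (_≢ 0ℚ) (sym (coeff₁-⊗-top (T ⊗ T) (affine c) (m ℕ.+ m) 1 T⊗T-degree (affine-degree c)))
      (*-≢0 T⊗T-leading (subst (_≢ 0ℚ) (sym (trans (coeff₁≡taylor₁ (affine c) 1) (order₁ (affine-jet c)))) c≢0))
    D≡ : m ℕ.+ m ℕ.+ 1 ≡ suc m ℕ.* 2 ∸ 1
    D≡ = solveℕ 1 (λ x → x :+ℕ x :+ℕ conℕ 1 :=ℕ conℕ 1 :+ℕ x :*ℕ conℕ 2) refl m

  indicator₃ : Indicator 3 m
  indicator₃ = record
    { poly      = complement W
    ; isFlat    = complement-flatIndicator 3 m W (s≤s z≤n) W-mult (order₀ W-jet) W-derivative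
    ; degree    = subst (λ d → DegreeAtMost d (complement W)) D≡ (complement-degree W W-degree)
    ; top≢0     = subst (λ d → coeff (complement W) (d ∷ []) ≢ 0ℚ) D≡ (complement-leading W (m ℕ.+ m ℕ.+ m ℕ.+ 2) (s≤s z≤n) W-leading)
    }
    where
    c = - (γ₁ + γ₁ + γ₁)
    d = δ m + δ m + δ m
    W = T ⊗ T ⊗ T ⊗ quadratic c d
    W-mult : ∀ x → 1 ≤ x → x ≤ m → MultAtLeast 3 W (x ∷ [])
    W-mult x 1≤x x≤m = MultAtLeast-⊗ (T ⊗ T ⊗ T) (quadratic c d) (x ∷ [])
      (MultAtLeast-⊗ (T ⊗ T) T (x ∷ []) (MultAtLeast-⊗ T T (x ∷ []) (T-mult x 1≤x x≤m) (T-mult x 1≤x x≤m)) (T-mult x 1≤x x≤m))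
      (MultAtLeast-zero (quadratic c d) (x ∷ []))
    W-jet : Jet₂ W 1ℚ 0ℚ 0ℚ
    W-jet = Jet₂-cong
      (solve 0 (con 1ℚ :* con 1ℚ :* con 1ℚ :* con 1ℚ := con 1ℚ) refl)
      (solve 1 (λ g → con 1ℚ :* con 1ℚ :* con 1ℚ :* (:- (g :+ g :+ g))
                      :+ (con 1ℚ :* con 1ℚ :* g :+ (con 1ℚ :* g :+ g :* con 1ℚ) :* con 1ℚ) :* con 1ℚ := con 0ℚ) refl γ₁)
      (solve 2 (λ g h → let δ′ = g :* g :+ g :* g :+ (:- h) in
                con 1ℚ :* con 1ℚ :* con 1ℚ :* (δ′ :+ δ′ :+ δ′)
                :+ ((con 1ℚ :* con 1ℚ :* g :+ (con 1ℚ :* g :+ g :* con 1ℚ) :* con 1ℚ) :* (:- (g :+ g :+ g))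
                    :+ (con 1ℚ :* con 1ℚ :* h :+ ((con 1ℚ :* g :+ g :* con 1ℚ) :* g
                                                :+ (con 1ℚ :* h :+ (g :* g :+ h :* con 1ℚ)) :* con 1ℚ)) :* con 1ℚ)
                := con 0ℚ) refl γ₁ γ₂)
      (Jet₂-⊗ (Jet₂-⊗ (Jet₂-⊗ (lagrange₀-jet m) (lagrange₀-jet m)) (lagrange₀-jet m)) (quadratic-jet c d))
    W-derivative : ∀ b → 0 < b → b < 3 → taylor₁ W 0 b ≡ 0ℚ
    W-derivative 1 _ _ = order₁ W-jet
    W-derivative 2 _ _ = order₂ W-jet
    W-derivative (suc (suc (suc _))) _ (s≤s (s≤s (s≤s ())))
    W-degree : DegreeAtMost (m ℕ.+ m ℕ.+ m ℕ.+ 2) W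
    W-degree = DegreeAtMost-⊗ (T ⊗ T ⊗ T) (quadratic c d) T⊗T⊗T-degree (quadratic-degree c d)
    d≢0 : d ≢ 0ℚ
    d≢0 d≡0 = ℚP.<-irrefl (sym d≡0) (ℚP.positive⁻¹ d {{d-positive}})
      where
      δ-pos = δ-positive m′
      d-positive : ℚ.Positive d
      d-positive = ℚP.pos+pos⇒pos (δ m + δ m) {{ℚP.pos+pos⇒pos (δ m) {{δ-pos}} (δ m) {{δ-pos}}}} (δ m) {{δ-pos}}
    W-leading : coeff W (m ℕ.+ m ℕ.+ m ℕ.+ 2 ∷ []) ≢ 0ℚ
    W-leading = subst (_≢ 0ℚ) (sym (coeff₁-⊗-top (T ⊗ T ⊗ T) (quadratic c d) (m ℕ.+ m ℕ.+ m) 2 T⊗T⊗T-degree (quadratic-degree c d)))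
      (*-≢0 T⊗T⊗T-leading (subst (_≢ 0ℚ) (sym (trans (coeff₁≡taylor₁ (quadratic c d) 2) (order₂ (quadratic-jet c d)))) d≢0))
    D≡ : m ℕ.+ m ℕ.+ m ℕ.+ 2 ≡ suc m ℕ.* 3 ∸ 1
    D≡ = solveℕ 1 (λ x → x :+ℕ x :+ℕ x :+ℕ conℕ 2 :=ℕ conℕ 2 :+ℕ x :*ℕ conℕ 3) refl m

ℕtoℚ-sum : ∀ {k} (f : Fin k → ℕ) → ℕtoℚ (ℕΣ.sum f) ≡ ℚΣ.sum (ℕtoℚ ∘ f)
ℕtoℚ-sum {zero}  f = refl
ℕtoℚ-sum {suc k} f = trans (ℕtoℚ-+ (f Fin.zero) (ℕΣ.sum (f ∘ Fin.suc))) (cong (ℕtoℚ (f Fin.zero) +_) (ℕtoℚ-sum (f ∘ Fin.suc)))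

unitᵛ : ∀ {n} → Fin n → ℕ → Exp n
unitᵛ i x = 0ᵛ V.[ i ]≔ x

unitᵛ-0 : ∀ {n} (i : Fin n) → unitᵛ i 0 ≡ 0ᵛ
unitᵛ-0 {suc n} Fin.zero    = refl
unitᵛ-0 {suc n} (Fin.suc i) = cong (0 ∷_) (unitᵛ-0 i)

tdeg-unitᵛ : ∀ {n} (i : Fin n) x → tdeg (unitᵛ i x) ≡ x
tdeg-unitᵛ {suc n} Fin.zero    x = trans (cong (x ℕ.+_) (tdeg-0ᵛ n)) (ℕP.+-identityʳ x)
tdeg-unitᵛ {suc n} (Fin.suc i) x = tdeg-unitᵛ i x

lookup-unitᵛ : ∀ {n} (i : Fin n) x → lookup (unitᵛ i x) i ≡ x
lookup-unitᵛ i x = VP.lookup∘updateAt i 0ᵛ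

unitᵛ-mono : ∀ {n} (i : Fin n) {x y} → x ≤ y → unitᵛ i x ≤ᵛ unitᵛ i y
unitᵛ-mono {suc n} Fin.zero    x≤y = x≤y ∷ ≤ᵛ-refl
unitᵛ-mono {suc n} (Fin.suc i) x≤y = z≤n ∷ unitᵛ-mono i x≤y

OnAxis : ∀ {n} → Fin n → Exp n → Set
OnAxis i β = β ≡ unitᵛ i (lookup β i)

≢0ᵛ⇒tdeg>0 : ∀ {n} (β : Exp n) → β ≢ 0ᵛ → 0 < tdeg β
≢0ᵛ⇒tdeg>0 β β≢0ᵛ = ℕP.n≢0⇒n>0 (β≢0ᵛ ∘ tdeg≡0⇒≡0ᵛ β)

monomialShift-unitᵛ : ∀ {n} (a : Vec ℕ n) i x b → monomialShift a (unitᵛ i x) (unitᵛ i b) ≡ binomialShift (lookup a i) x b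
monomialShift-unitᵛ (a₀ ∷ a) Fin.zero    x b = trans (cong (binomialShift a₀ x b ℕ.*_) (monomialShift-0ᵛ-0ᵛ a)) (ℕP.*-identityʳ (binomialShift a₀ x b))
monomialShift-unitᵛ (a₀ ∷ a) (Fin.suc i) x b = trans (ℕP.+-identityʳ _) (monomialShift-unitᵛ a i x b)

monomialShift-unitᵛ-off : ∀ {n} (a : Vec ℕ n) i x β → ¬ OnAxis i β → monomialShift a (unitᵛ i x) β ≡ 0
monomialShift-unitᵛ-off (a₀ ∷ a) Fin.zero    x (y ∷ β) off =
  trans (cong (binomialShift a₀ x y ℕ.*_) (monomialShift-0ᵛ-positive a β (≢0ᵛ⇒tdeg>0 β (off ∘ cong (y ∷_))))) (ℕP.*-zeroʳ (binomialShift a₀ x y))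
monomialShift-unitᵛ-off (a₀ ∷ a) (Fin.suc i) x (zero  ∷ β) off =
  trans (ℕP.+-identityʳ _) (monomialShift-unitᵛ-off a i x β (off ∘ cong (0 ∷_)))
monomialShift-unitᵛ-off (a₀ ∷ a) (Fin.suc i) x (suc y ∷ β) off = refl

embed : ∀ {n} → Fin n → Poly 1 → Poly n
embed i = L.map (λ t → (proj₁ t , unitᵛ i (V.head (proj₂ t))))

coeffShift-embed : ∀ {n} (i : Fin n) p a b → coeffShift (embed i p) a (unitᵛ i b) ≡ taylor₁ p (lookup a i) b
coeffShift-embed i p a b = trans (sumOver-map p _ (shiftTerm a (unitᵛ i b))) (sumOver-cong p term)
  where
  term : ∀ t → shiftTerm a (unitᵛ i b) (proj₁ t , unitᵛ i (V.head (proj₂ t))) ≡ shiftTerm (lookup a i ∷ []) (b ∷ []) t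
  term (c , x ∷ []) = cong (λ k → c * ℕtoℚ k)
    (trans (monomialShift-unitᵛ a i x b) (sym (ℕP.*-identityʳ (binomialShift (lookup a i) x b))))

coeffShift-embed-off : ∀ {n} (i : Fin n) p a β → ¬ OnAxis i β → coeffShift (embed i p) a β ≡ 0ℚ
coeffShift-embed-off i p a β off = trans (sumOver-map p _ (shiftTerm a β))
  (trans (sumOver-cong p term) (sumOver-zero p))
  where
  term : ∀ t → shiftTerm a β (proj₁ t , unitᵛ i (V.head (proj₂ t))) ≡ 0ℚ
  term (c , x ∷ []) = trans (cong (λ k → c * ℕtoℚ k) (monomialShift-unitᵛ-off a i x β off)) (ℚP.*-zeroʳ c)

coeffShift-embed-0ᵛ : ∀ {n} (i : Fin n) p a → coeffShift (embed i p) a 0ᵛ ≡ taylor₁ p (lookup a i) 0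
coeffShift-embed-0ᵛ i p a = trans (cong (coeffShift (embed i p) a) (sym (unitᵛ-0 i))) (coeffShift-embed i p a 0)

SupportedOn-embed : ∀ {n} {A : Exp 1 → Set} (i : Fin n) p → SupportedOn A p →
  SupportedOn (λ β → ∃ λ x → β ≡ unitᵛ i x × A (x ∷ [])) (embed i p)
SupportedOn-embed i p suppP β coeff≢0 with β ≟ₑ unitᵛ i (lookup β i)
... | no off    = ⊥-elim (coeff≢0 (trans (coeff≡coeffShift-0ᵛ (embed i p) β) (coeffShift-embed-off i p 0ᵛ β off)))
... | yes on rewrite on = lookup β i , refl , suppP (lookup β i ∷ []) λ ≡0 → coeff≢0 (begin
  coeff (embed i p) (unitᵛ i (lookup β i))           ≡⟨ coeff≡coeffShift-0ᵛ (embed i p) (unitᵛ i (lookup β i)) ⟩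
  coeffShift (embed i p) 0ᵛ (unitᵛ i (lookup β i))   ≡⟨ coeffShift-embed i p 0ᵛ (lookup β i) ⟩
  taylor₁ p (lookup 0ᵛ i) (lookup β i)               ≡⟨ cong (λ x → taylor₁ p x (lookup β i)) (VP.lookup-replicate i 0) ⟩
  taylor₁ p 0 (lookup β i)                           ≡⟨ sym (coeff₁≡taylor₁ p (lookup β i)) ⟩
  coeff p (lookup β i ∷ [])                          ≡⟨ ≡0 ⟩
  0ℚ                                                 ∎)
  where open ≡-Reasoning

⨁ : ∀ {n k} → (Fin k → Poly n) → Poly n
⨁ {k = zero}  F = []
⨁ {k = suc k} F = F Fin.zero ⊕ ⨁ (F ∘ Fin.suc)

⨂ : ∀ {n k} → (Fin k → Poly n) → Poly n
⨂ {k = zero}  F = const 1ℚ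
⨂ {k = suc k} F = F Fin.zero ⊗ ⨂ (F ∘ Fin.suc)

⨁ᵛ : ∀ {n k} → (Fin k → Exp n) → Exp n
⨁ᵛ {k = zero}  U = 0ᵛ
⨁ᵛ {k = suc k} U = U Fin.zero +ᵛ ⨁ᵛ (U ∘ Fin.suc)

coeffShift-⨁ : ∀ {n k} (F : Fin k → Poly n) a β → coeffShift (⨁ F) a β ≡ ℚΣ.sum (λ i → coeffShift (F i) a β)
coeffShift-⨁ {k = zero}  F a β = refl
coeffShift-⨁ {k = suc k} F a β = trans (coeffShift-⊕ (F Fin.zero) (⨁ (F ∘ Fin.suc)) a β)
  (cong (coeffShift (F Fin.zero) a β +_) (coeffShift-⨁ (F ∘ Fin.suc) a β))

SupportedOn-⨁ : ∀ {n k} {A : Exp n → Set} (F : Fin k → Poly n) → (∀ i → SupportedOn A (F i)) → SupportedOn A (⨁ F)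
SupportedOn-⨁ {k = zero}  F suppF = SupportedOn-[]
SupportedOn-⨁ {k = suc k} F suppF =
  SupportedOn-⊕ (F Fin.zero) (⨁ (F ∘ Fin.suc)) (suppF Fin.zero) (SupportedOn-⨁ (F ∘ Fin.suc) (suppF ∘ Fin.suc))

MultAtLeast-⨂ : ∀ {n k} (F : Fin k → Poly n) a (r : Fin k → ℕ) → (∀ i → MultAtLeast (r i) (F i) a) →
  MultAtLeast (ℕΣ.sum r) (⨂ F) a
MultAtLeast-⨂ {k = zero}  F a r multF = MultAtLeast-zero (const 1ℚ) a
MultAtLeast-⨂ {k = suc k} F a r multF = MultAtLeast-⊗ (F Fin.zero) (⨂ (F ∘ Fin.suc)) a
  (multF Fin.zero) (MultAtLeast-⨂ (F ∘ Fin.suc) a (r ∘ Fin.suc) (multF ∘ Fin.suc))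

SupportedOn-const : ∀ {n} c → SupportedOn (_≤ᵛ 0ᵛ {n}) (const c)
SupportedOn-const {n} c β coeff≢0 = subst (_≤ᵛ 0ᵛ) (sym (tdeg≡0⇒≡0ᵛ β (ℕP.n≤0⇒n≡0 (DegreeAtMost-const c β coeff≢0)))) ≤ᵛ-refl

SupportedOn-⨂ : ∀ {n k} (F : Fin k → Poly n) (U : Fin k → Exp n) →
  (∀ i → SupportedOn (_≤ᵛ U i) (F i)) → SupportedOn (_≤ᵛ ⨁ᵛ U) (⨂ F)
SupportedOn-⨂ {k = zero}  F U suppF = SupportedOn-const 1ℚ
SupportedOn-⨂ {k = suc k} F U suppF = SupportedOn-mono (⨂ F) (λ { β (β₁ , β₂ , refl , β₁≤ , β₂≤) → +ᵛ-mono-≤ᵛ β₁≤ β₂≤ })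
  (SupportedOn-⊗ (F Fin.zero) (⨂ (F ∘ Fin.suc)) (suppF Fin.zero) (SupportedOn-⨂ (F ∘ Fin.suc) (U ∘ Fin.suc) (suppF ∘ Fin.suc)))

coeff-⨂-top : ∀ {n k} (F : Fin k → Poly n) (U : Fin k → Exp n) → (∀ i → SupportedOn (_≤ᵛ U i) (F i)) →
  (∀ i → coeff (F i) (U i) ≢ 0ℚ) → coeff (⨂ F) (⨁ᵛ U) ≢ 0ℚ
coeff-⨂-top {n} {zero} F U suppF topF = subst (_≢ 0ℚ) (sym (trans (coeff≡coeffShift-0ᵛ (const 1ℚ) (0ᵛ {n})) (coeffShift-const-0ᵛ 1ℚ (0ᵛ {n})))) (λ ())
coeff-⨂-top {n} {suc k} F U suppF topF = subst (_≢ 0ℚ) (sym top)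
  (*-≢0 (topF Fin.zero) (subst (λ β → coeff (⨂ (F ∘ Fin.suc)) β ≢ 0ℚ) (sym (+ᵛ-∸ᵛ-cancelˡ U₀ ΣU))
                                (coeff-⨂-top (F ∘ Fin.suc) (U ∘ Fin.suc) (suppF ∘ Fin.suc) (topF ∘ Fin.suc))))
  where
  U₀ = U Fin.zero
  ΣU = ⨁ᵛ (U ∘ Fin.suc)
  top : coeff (⨂ F) (U₀ +ᵛ ΣU) ≡ coeff (F Fin.zero) U₀ * coeff (⨂ (F ∘ Fin.suc)) ((U₀ +ᵛ ΣU) ∸ᵛ U₀)
  top = TopCoefficient.coeff-⊗-top (F Fin.zero) (⨂ (F ∘ Fin.suc)) U₀ (tdeg ΣU) (U₀ +ᵛ ΣU) (suppF Fin.zero)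
    (SupportedOn-mono (⨂ (F ∘ Fin.suc)) (λ β → tdeg-mono-≤ᵛ) (SupportedOn-⨂ (F ∘ Fin.suc) (U ∘ Fin.suc) (suppF ∘ Fin.suc)))
    (tdeg-+ᵛ U₀ ΣU) (≤ᵛ-+ᵛ U₀ ΣU)

⨁ᵛ-∷0 : ∀ {n k} (U : Fin k → Exp n) → ⨁ᵛ (λ i → 0 ∷ U i) ≡ 0 ∷ ⨁ᵛ U
⨁ᵛ-∷0 {k = zero}  U = refl
⨁ᵛ-∷0 {k = suc k} U = cong ((0 ∷ U Fin.zero) +ᵛ_) (⨁ᵛ-∷0 (U ∘ Fin.suc))

⨁ᵛ-unitᵛ : ∀ n x → ⨁ᵛ (λ (i : Fin n) → unitᵛ i x) ≡ replicate n x
⨁ᵛ-unitᵛ zero    x = refl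
⨁ᵛ-unitᵛ (suc n) x = trans (cong ((x ∷ 0ᵛ) +ᵛ_) (⨁ᵛ-∷0 (λ i → unitᵛ i x)))
  (cong₂ _∷_ (ℕP.+-identityʳ x) (trans (0ᵛ-+ᵛ _) (⨁ᵛ-unitᵛ n x)))

-- Counting nonzero coordinates on the grid

InGrid : ∀ {n} → ℕ → Vec ℕ n → Set
InGrid m a = ∀ i → lookup a i ≤ m

nonzeroCount : ∀ {n} → Vec ℕ n → ℕ
nonzeroCount a = ℕΣ.sum (λ i → nonzeroIndicator (lookup a i))

nonzeroCount≡0⇒≡0ᵛ : ∀ {n} (a : Vec ℕ n) → nonzeroCount a ≡ 0 → a ≡ 0ᵛ
nonzeroCount≡0⇒≡0ᵛ []         _     = refl
nonzeroCount≡0⇒≡0ᵛ (zero ∷ a) count≡0 = cong (0 ∷_) (nonzeroCount≡0⇒≡0ᵛ a count≡0)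

counter : ∀ {n} → Poly 1 → Poly n
counter e = ⨁ (λ i → embed i e)

shiftedCounter : ∀ {n} → Poly 1 → Poly n
shiftedCounter e = counter e ⊕ const (- 1ℚ)

module _ {r m : ℕ} {e : Poly 1} (flat : FlatIndicator r m e) {n : ℕ} (a : Vec ℕ n) (a∈grid : InGrid m a) where

  counter-value : coeffShift (counter e) a 0ᵛ ≡ ℕtoℚ (nonzeroCount a)
  counter-value = trans (coeffShift-⨁ (λ i → embed i e) a 0ᵛ)
    (trans (ℚΣ.sum-cong-≗ (λ i → trans (coeffShift-embed-0ᵛ i e a) (FlatIndicator.value flat (lookup a i) (a∈grid i))))
           (sym (ℕtoℚ-sum (λ i → nonzeroIndicator (lookup a i)))))

  counter-flat : ∀ β → 0 < tdeg β → tdeg β < r → coeffShift (counter e) a β ≡ 0ℚ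
  counter-flat β 0<β β<r = trans (coeffShift-⨁ (λ i → embed i e) a β)
    (trans (ℚΣ.sum-cong-≗ term≡0) (ℚΣ.sum-replicate-zero n))
    where
    term≡0 : ∀ i → coeffShift (embed i e) a β ≡ 0ℚ
    term≡0 i with β ≟ₑ unitᵛ i (lookup β i)
    ... | no off = coeffShift-embed-off i e a β off
    ... | yes on = trans (cong (coeffShift (embed i e) a) on)
      (trans (coeffShift-embed i e a (lookup β i))
             (FlatIndicator.derivative flat (lookup a i) (a∈grid i) (lookup β i) (subst (0 <_) β≡βᵢ 0<β) (subst (_< r) β≡βᵢ β<r)))
      where
      β≡βᵢ : tdeg β ≡ lookup β i
      β≡βᵢ = trans (cong tdeg on) (tdeg-unitᵛ i (lookup β i))

  shiftedCounter-value : coeffShift (shiftedCounter e) a 0ᵛ ≡ ℕtoℚ (nonzeroCount a) + - 1ℚ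
  shiftedCounter-value = trans (coeffShift-⊕ (counter e) (const (- 1ℚ)) a 0ᵛ)
    (cong₂ _+_ counter-value (coeffShift-const-0ᵛ (- 1ℚ) a))

  shiftedCounter-flat : ∀ β → 0 < tdeg β → tdeg β < r → coeffShift (shiftedCounter e) a β ≡ 0ℚ
  shiftedCounter-flat β 0<β β<r = trans (coeffShift-⊕ (counter e) (const (- 1ℚ)) a β)
    (trans (cong₂ _+_ (counter-flat β 0<β β<r) (coeffShift-const-positive (- 1ℚ) a β 0<β)) (ℚP.+-identityˡ 0ℚ))

  shiftedCounter-mult : nonzeroCount a ≡ 1 → MultAtLeast r (shiftedCounter e) a
  shiftedCounter-mult count≡1 β β<r with tdeg β ℕ.≟ 0
  ... | no β≢0    = shiftedCounter-flat β (ℕP.n≢0⇒n>0 β≢0) β<r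
  ... | yes β≡0 rewrite tdeg≡0⇒≡0ᵛ β β≡0 =
    trans shiftedCounter-value (trans (cong (λ c → ℕtoℚ c + - 1ℚ) count≡1) (ℚP.+-inverseʳ 1ℚ))

G : ∀ n → ℕ → Poly n
G n m = ⨂ (λ (i : Fin n) → embed i (lagrange₀ m))

G-mult : ∀ {n} m (a : Vec ℕ n) → InGrid m a → MultAtLeast (nonzeroCount a) (G n m) a
G-mult m a a∈grid = MultAtLeast-⨂ (λ i → embed i (lagrange₀ m)) a (λ i → nonzeroIndicator (lookup a i)) factor
  where
  factor : ∀ i → MultAtLeast (nonzeroIndicator (lookup a i)) (embed i (lagrange₀ m)) a
  factor i with lookup a i in aᵢ≡
  ... | zero  = MultAtLeast-zero (embed i (lagrange₀ m)) a
  ... | suc x = MultAtLeast-1 (embed i (lagrange₀ m)) a (trans (coeffShift-embed-0ᵛ i (lagrange₀ m) a)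
    (trans (cong (λ y → taylor₁ (lagrange₀ m) y 0) aᵢ≡) (lagrange₀-root m (suc x) (s≤s z≤n) (subst (_≤ m) aᵢ≡ (a∈grid i)))))

G-factor-support : ∀ {n} m (i : Fin n) → SupportedOn (_≤ᵛ unitᵛ i m) (embed i (lagrange₀ m))
G-factor-support m i = SupportedOn-mono (embed i (lagrange₀ m))
  (λ { β (x , refl , x≤m) → unitᵛ-mono i (subst (_≤ m) (ℕP.+-identityʳ x) x≤m) })
  (SupportedOn-embed i (lagrange₀ m) (lagrange₀-degree m))

G-support : ∀ n m → SupportedOn (_≤ᵛ replicate n m) (G n m)
G-support n m = subst (λ U → SupportedOn (_≤ᵛ U) (G n m)) (⨁ᵛ-unitᵛ n m)
  (SupportedOn-⨂ (λ (i : Fin n) → embed i (lagrange₀ m)) (λ i → unitᵛ i m) (G-factor-support m))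

G-top : ∀ n m → coeff (G n m) (replicate n m) ≢ 0ℚ
G-top n m = subst (λ U → coeff (G n m) U ≢ 0ℚ) (⨁ᵛ-unitᵛ n m)
  (coeff-⨂-top (λ (i : Fin n) → embed i (lagrange₀ m)) (λ i → unitᵛ i m) (G-factor-support m) factor-top)
  where
  factor-top : ∀ (i : Fin n) → coeff (embed i (lagrange₀ m)) (unitᵛ i m) ≢ 0ℚ
  factor-top i = subst (_≢ 0ℚ) (sym (begin
    coeff (embed i (lagrange₀ m)) (unitᵛ i m)           ≡⟨ coeff≡coeffShift-0ᵛ (embed i (lagrange₀ m)) (unitᵛ i m) ⟩
    coeffShift (embed i (lagrange₀ m)) 0ᵛ (unitᵛ i m)   ≡⟨ coeffShift-embed i (lagrange₀ m) 0ᵛ m ⟩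
    taylor₁ (lagrange₀ m) (lookup 0ᵛ i) m               ≡⟨ cong (λ x → taylor₁ (lagrange₀ m) x m) (VP.lookup-replicate i 0) ⟩
    taylor₁ (lagrange₀ m) 0 m                           ≡⟨ sym (coeff₁≡taylor₁ (lagrange₀ m) m) ⟩
    coeff (lagrange₀ m) (m ∷ [])                        ≡⟨ coeff-lagrange₀-top m ⟩
    lagrange₀-lc m                                           ∎)) (lagrange₀-lc≢0 m)
    where open ≡-Reasoning

-- The factors H₂, H₃, H₄

½ ³⁄₂ : ℚ
½ = ℤ.1ℤ ℚ./ 2
³⁄₂ = ℤ.+ 3 ℚ./ 2

H₂ : ∀ {n} → Poly 1 → Poly n
H₂ e₁ = shiftedCounter e₁

H₃ : ∀ {n} → Poly 1 → Poly 1 → Poly n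
H₃ e₁ e₂ = shiftedCounter e₂ ⊕ (- 1ℚ) · (shiftedCounter e₁ ⊗ shiftedCounter e₁)

H₄ : ∀ {n} → Poly 1 → Poly 1 → Poly 1 → Poly n
H₄ e₁ e₂ e₃ = shiftedCounter e₃ ⊕ ½ · (Y₁ ⊗ (Y₁ ⊗ Y₁)) ⊕ (- ³⁄₂) · (shiftedCounter e₂ ⊗ Y₁)
  where Y₁ = shiftedCounter e₁

module _ {m n : ℕ} {e₁ : Poly 1} (flat₁ : FlatIndicator 1 m e₁) (a : Vec ℕ n) (a∈grid : InGrid m a) where

  private
    Y₁ : Poly n
    Y₁ = shiftedCounter e₁
    s = nonzeroCount a
    v = ℕtoℚ s + - 1ℚ
    val : Poly n → ℚ
    val P = coeffShift P a 0ᵛ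
    ∂ : Poly n → Exp n → ℚ
    ∂ P β = coeffShift P a β

    linear≡0 : ∀ {r e} → FlatIndicator r m e → 2 ≤ r → ∀ β → tdeg β ≡ 1 → ∂ (shiftedCounter e) β ≡ 0ℚ
    linear≡0 {r} flat 2≤r β β≡1 =
      shiftedCounter-flat flat a a∈grid β (subst (0 <_) (sym β≡1) (s≤s z≤n)) (subst (_< r) (sym β≡1) 2≤r)

  H₂-mult : s ≡ 1 → MultAtLeast 1 (H₂ e₁) a
  H₂-mult = shiftedCounter-mult flat₁ a a∈grid

  module _ {e₂ : Poly 1} (flat₂ : FlatIndicator 2 m e₂) where

    private
      Y₂ : Poly n
      Y₂ = shiftedCounter e₂

    H₃-mult-1 : s ≡ 1 → MultAtLeast 2 (H₃ e₁ e₂) a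
    H₃-mult-1 s≡1 = MultAtLeast-⊕ Y₂ ((- 1ℚ) · (Y₁ ⊗ Y₁)) a (shiftedCounter-mult flat₂ a a∈grid s≡1)
      (MultAtLeast-· (- 1ℚ) (Y₁ ⊗ Y₁) a (MultAtLeast-⊗ Y₁ Y₁ a (H₂-mult s≡1) (H₂-mult s≡1)))

    H₃-value : ∀ c → s ≡ c → val (H₃ e₁ e₂) ≡ (ℕtoℚ c + - 1ℚ) + - 1ℚ * ((ℕtoℚ c + - 1ℚ) * (ℕtoℚ c + - 1ℚ))
    H₃-value c refl = trans (coeffShift-⊕ Y₂ ((- 1ℚ) · (Y₁ ⊗ Y₁)) a 0ᵛ)
      (cong₂ _+_ (shiftedCounter-value flat₂ a a∈grid)
                 (trans (coeffShift-· (- 1ℚ) (Y₁ ⊗ Y₁) a 0ᵛ)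
                        (cong (- 1ℚ *_) (trans (coeffShift-⊗-0ᵛ Y₁ Y₁ a) (cong₂ _*_ Y₁≡v Y₁≡v)))))
      where Y₁≡v = shiftedCounter-value flat₁ a a∈grid

    H₃-mult-2 : s ≡ 2 → MultAtLeast 1 (H₃ e₁ e₂) a
    H₃-mult-2 s≡2 = MultAtLeast-1 (H₃ e₁ e₂) a (H₃-value 2 s≡2)

    module _ {e₃ : Poly 1} (flat₃ : FlatIndicator 3 m e₃) where

      private
        Y₃ A B : Poly n
        Y₃ = shiftedCounter e₃
        A = ½ · (Y₁ ⊗ (Y₁ ⊗ Y₁))
        B = (- ³⁄₂) · (Y₂ ⊗ Y₁)

        ∂H₄ : ∀ β → ∂ (H₄ e₁ e₂ e₃) β ≡ ∂ Y₃ β + ½ * ∂ (Y₁ ⊗ (Y₁ ⊗ Y₁)) β + (- ³⁄₂) * ∂ (Y₂ ⊗ Y₁) β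
        ∂H₄ β = trans (coeffShift-⊕ (Y₃ ⊕ A) B a β)
          (cong₂ _+_ (trans (coeffShift-⊕ Y₃ A a β) (cong (∂ Y₃ β +_) (coeffShift-· ½ (Y₁ ⊗ (Y₁ ⊗ Y₁)) a β)))
                     (coeffShift-· (- ³⁄₂) (Y₂ ⊗ Y₁) a β))

      H₄-mult-1 : s ≡ 1 → MultAtLeast 3 (H₄ e₁ e₂ e₃) a
      H₄-mult-1 s≡1 = MultAtLeast-⊕ (Y₃ ⊕ A) B a
        (MultAtLeast-⊕ Y₃ A a (shiftedCounter-mult flat₃ a a∈grid s≡1)
          (MultAtLeast-· ½ (Y₁ ⊗ (Y₁ ⊗ Y₁)) a (MultAtLeast-⊗ Y₁ (Y₁ ⊗ Y₁) a Y₁-mult (MultAtLeast-⊗ Y₁ Y₁ a Y₁-mult Y₁-mult))))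
        (MultAtLeast-· (- ³⁄₂) (Y₂ ⊗ Y₁) a (MultAtLeast-⊗ Y₂ Y₁ a (shiftedCounter-mult flat₂ a a∈grid s≡1) Y₁-mult))
        where Y₁-mult = H₂-mult s≡1

      H₄-value : ∀ c → s ≡ c → let w = ℕtoℚ c + - 1ℚ in val (H₄ e₁ e₂ e₃) ≡ w + ½ * (w * (w * w)) + (- ³⁄₂) * (w * w)
      H₄-value c refl = begin
        val (H₄ e₁ e₂ e₃)                                          ≡⟨ ∂H₄ 0ᵛ ⟩
        val Y₃ + ½ * val (Y₁ ⊗ (Y₁ ⊗ Y₁)) + (- ³⁄₂) * val (Y₂ ⊗ Y₁) ≡⟨ cong₂ (λ u w → val Y₃ + ½ * u + (- ³⁄₂) * w) cube product ⟩
        val Y₃ + ½ * (v * (v * v)) + (- ³⁄₂) * (v * v)             ≡⟨ cong (λ y → y + ½ * (v * (v * v)) + (- ³⁄₂) * (v * v)) Y₃≡v ⟩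
        v + ½ * (v * (v * v)) + (- ³⁄₂) * (v * v)                  ∎
        where
        open ≡-Reasoning
        Y₁≡v = shiftedCounter-value flat₁ a a∈grid
        Y₂≡v = shiftedCounter-value flat₂ a a∈grid
        Y₃≡v = shiftedCounter-value flat₃ a a∈grid
        cube : val (Y₁ ⊗ (Y₁ ⊗ Y₁)) ≡ v * (v * v)
        cube = trans (coeffShift-⊗-0ᵛ Y₁ (Y₁ ⊗ Y₁) a) (cong₂ _*_ Y₁≡v (trans (coeffShift-⊗-0ᵛ Y₁ Y₁ a) (cong₂ _*_ Y₁≡v Y₁≡v)))
        product : val (Y₂ ⊗ Y₁) ≡ v * v
        product = trans (coeffShift-⊗-0ᵛ Y₂ Y₁ a) (cong₂ _*_ Y₂≡v Y₁≡v)

      -- At s = 2 the first-order terms of Y₁³/2 and −3 Y₂ Y₁/2 cancel, those of Y₂ and Y₃ vanish.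
      H₄-mult-2 : s ≡ 2 → MultAtLeast 2 (H₄ e₁ e₂ e₃) a
      H₄-mult-2 s≡2 = MultAtLeast-2 (H₄ e₁ e₂ e₃) a (H₄-value 2 s≡2) linear
        where
        Y≡1 : ∀ {e r} → FlatIndicator r m e → val (shiftedCounter e) ≡ 1ℚ
        Y≡1 flat = trans (shiftedCounter-value flat a a∈grid) (cong (λ s → ℕtoℚ s + - 1ℚ) s≡2)
        linear : ∀ β → tdeg β ≡ 1 → ∂ (H₄ e₁ e₂ e₃) β ≡ 0ℚ
        linear β β≡1 = begin
          ∂ (H₄ e₁ e₂ e₃) β
            ≡⟨ ∂H₄ β ⟩
          ∂ Y₃ β + ½ * ∂ (Y₁ ⊗ (Y₁ ⊗ Y₁)) β + (- ³⁄₂) * ∂ (Y₂ ⊗ Y₁) β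
            ≡⟨ cong₂ (λ u w → ∂ Y₃ β + ½ * u + (- ³⁄₂) * w)
                 (trans (coeffShift-⊗-tdeg≡1 Y₁ (Y₁ ⊗ Y₁) a β β≡1)
                        (cong₂ (λ u w → val Y₁ * u + ∂ Y₁ β * w) (coeffShift-⊗-tdeg≡1 Y₁ Y₁ a β β≡1) (coeffShift-⊗-0ᵛ Y₁ Y₁ a)))
                 (coeffShift-⊗-tdeg≡1 Y₂ Y₁ a β β≡1) ⟩
          ∂ Y₃ β + ½ * (val Y₁ * (val Y₁ * ∂ Y₁ β + ∂ Y₁ β * val Y₁) + ∂ Y₁ β * (val Y₁ * val Y₁))
                 + (- ³⁄₂) * (val Y₂ * ∂ Y₁ β + ∂ Y₂ β * val Y₁)
            ≡⟨ cong₂ (λ u w → u + ½ * (w * (w * ∂ Y₁ β + ∂ Y₁ β * w) + ∂ Y₁ β * (w * w)) + (- ³⁄₂) * (val Y₂ * ∂ Y₁ β + ∂ Y₂ β * w))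
                     (linear≡0 flat₃ (s≤s (s≤s z≤n)) β β≡1) (Y≡1 flat₁) ⟩
          0ℚ + ½ * (1ℚ * (1ℚ * ∂ Y₁ β + ∂ Y₁ β * 1ℚ) + ∂ Y₁ β * (1ℚ * 1ℚ)) + (- ³⁄₂) * (val Y₂ * ∂ Y₁ β + ∂ Y₂ β * 1ℚ)
            ≡⟨ cong₂ (λ u w → 0ℚ + ½ * (1ℚ * (1ℚ * ∂ Y₁ β + ∂ Y₁ β * 1ℚ) + ∂ Y₁ β * (1ℚ * 1ℚ)) + (- ³⁄₂) * (u * ∂ Y₁ β + w * 1ℚ))
                     (Y≡1 flat₂) (linear≡0 flat₂ ℕP.≤-refl β β≡1) ⟩
          0ℚ + ½ * (1ℚ * (1ℚ * ∂ Y₁ β + ∂ Y₁ β * 1ℚ) + ∂ Y₁ β * (1ℚ * 1ℚ)) + (- ³⁄₂) * (1ℚ * ∂ Y₁ β + 0ℚ * 1ℚ)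
            ≡⟨ solve 1 (λ d → con 0ℚ :+ con ½ :* (con 1ℚ :* (con 1ℚ :* d :+ d :* con 1ℚ) :+ d :* (con 1ℚ :* con 1ℚ))
                              :+ con (- ³⁄₂) :* (con 1ℚ :* d :+ con 0ℚ :* con 1ℚ) := con 0ℚ) refl (∂ Y₁ β) ⟩
          0ℚ ∎
          where open ≡-Reasoning

      H₄-mult-3 : s ≡ 3 → MultAtLeast 1 (H₄ e₁ e₂ e₃) a
      H₄-mult-3 s≡3 = MultAtLeast-1 (H₄ e₁ e₂ e₃) a (H₄-value 3 s≡3)

axisCount : ∀ {n} → Exp n → ℕ → ℚ
axisCount γ D = ℚΣ.sum (λ j → if does (γ ≟ₑ unitᵛ j D) then 1ℚ else 0ℚ)

coeff-counter-top : ∀ {n} e D (γ : Exp n) → tdeg γ ≡ D → coeff (counter e) γ ≡ coeff e (D ∷ []) * axisCount γ D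
coeff-counter-top {n} e D γ γ≡D = begin
  coeff (counter e) γ                                                  ≡⟨ coeff≡coeffShift-0ᵛ (counter e) γ ⟩
  coeffShift (counter e) 0ᵛ γ                                          ≡⟨ coeffShift-⨁ (λ i → embed i e) 0ᵛ γ ⟩
  ℚΣ.sum (λ j → coeffShift (embed j e) 0ᵛ γ)                           ≡⟨ ℚΣ.sum-cong-≗ term ⟩
  ℚΣ.sum (λ j → lc * axis j)                                           ≡⟨ sym (ℚΣ.*-distribˡ-sum lc axis) ⟩
  lc * axisCount γ D                                                   ∎
  where
  open ≡-Reasoning
  lc = coeff e (D ∷ [])
  axis : Fin n → ℚ
  axis j = if does (γ ≟ₑ unitᵛ j D) then 1ℚ else 0ℚ
  term : ∀ j → coeffShift (embed j e) 0ᵛ γ ≡ lc * axis j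
  term j with γ ≟ₑ unitᵛ j D
  ... | yes refl = trans (coeffShift-embed j e 0ᵛ D)
    (trans (cong (λ x → taylor₁ e x D) (VP.lookup-replicate j 0)) (trans (sym (coeff₁≡taylor₁ e D)) (sym (ℚP.*-identityʳ lc))))
  ... | no γ≢ = trans (coeffShift-embed-off j e 0ᵛ γ off) (sym (ℚP.*-zeroʳ lc))
    where
    off : ¬ OnAxis j γ
    off on = γ≢ (trans on (cong (unitᵛ j) (trans (sym (tdeg-unitᵛ j (lookup γ j))) (trans (cong tdeg (sym on)) γ≡D))))

coeff-shiftedCounter-top : ∀ {n} e D (γ : Exp n) → 0 < D → tdeg γ ≡ D → coeff (shiftedCounter e) γ ≡ coeff e (D ∷ []) * axisCount γ D
coeff-shiftedCounter-top e D γ 0<D γ≡D = trans (coeff-⊕-lower (counter e) (const (- 1ℚ)) γ (DegreeAtMost-const (- 1ℚ))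
                                                             (subst (0 <_) (sym γ≡D) 0<D))
                                               (coeff-counter-top e D γ γ≡D)

shiftedCounter-degree : ∀ {n d} e → DegreeAtMost d e → DegreeAtMost d (shiftedCounter {n} e)
shiftedCounter-degree {n} {d} e deg-e = SupportedOn-⊕ (counter e) (const (- 1ℚ))
  (SupportedOn-⨁ (λ i → embed i e) λ i → SupportedOn-mono (embed i e)
     (λ { β (x , refl , x≤d) → subst (_≤ d) (sym (trans (tdeg-unitᵛ i x) (sym (ℕP.+-identityʳ x)))) x≤d })
     (SupportedOn-embed i e deg-e))
  (DegreeAtMost-mono (const (- 1ℚ)) z≤n (DegreeAtMost-const (- 1ℚ)))

Weighted : ∀ {n} → ℕ → ℕ → Exp n → Set
Weighted m w γ = ∃ λ t → tdeg t ≤ w × γ ≤ᵛ V.map (suc m ℕ.*_) t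

module _ {n : ℕ} (m : ℕ) where

  Weighted-mono : ∀ {w w′} (P : Poly n) → w ≤ w′ → SupportedOn (Weighted m w) P → SupportedOn (Weighted m w′) P
  Weighted-mono P w≤w′ = SupportedOn-mono P (λ { β (t , t≤w , β≤) → t , ℕP.≤-trans t≤w w≤w′ , β≤ })

  Weighted-⊗ : ∀ {w w′} (P Q : Poly n) → SupportedOn (Weighted m w) P → SupportedOn (Weighted m w′) Q →
    SupportedOn (Weighted m (w ℕ.+ w′)) (P ⊗ Q)
  Weighted-⊗ P Q wP wQ = SupportedOn-mono (P ⊗ Q)
    (λ { β (β₁ , β₂ , refl , (t , t≤ , β₁≤) , (t′ , t′≤ , β₂≤)) →
         t +ᵛ t′ , subst (_≤ _) (sym (tdeg-+ᵛ t t′)) (ℕP.+-mono-≤ t≤ t′≤)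
                 , subst (β₁ +ᵛ β₂ ≤ᵛ_) (sym (map-*-+ᵛ t t′)) (+ᵛ-mono-≤ᵛ β₁≤ β₂≤) })
    (SupportedOn-⊗ P Q wP wQ)
    where
    map-*-+ᵛ : ∀ {k} (t t′ : Exp k) → V.map (suc m ℕ.*_) (t +ᵛ t′) ≡ V.map (suc m ℕ.*_) t +ᵛ V.map (suc m ℕ.*_) t′
    map-*-+ᵛ []      []        = refl
    map-*-+ᵛ (x ∷ t) (x′ ∷ t′) = cong₂ _∷_ (ℕP.*-distribˡ-+ (suc m) x x′) (map-*-+ᵛ t t′)

  Weighted-const : ∀ c → SupportedOn (Weighted m 0) (const {n} c)
  Weighted-const c = SupportedOn-mono (const c)
    (λ β β≤0ᵛ → 0ᵛ , ℕP.≤-reflexive (tdeg-0ᵛ n) , subst (β ≤ᵛ_) (sym map-0ᵛ) β≤0ᵛ) (SupportedOn-const c)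
    where
    map-0ᵛ : ∀ {k} → V.map (suc m ℕ.*_) (0ᵛ {k}) ≡ 0ᵛ
    map-0ᵛ {zero}  = refl
    map-0ᵛ {suc k} = cong₂ _∷_ (ℕP.*-zeroʳ (suc m)) map-0ᵛ

  Weighted-shiftedCounter : ∀ r e → DegreeAtMost (suc m ℕ.* r) e → SupportedOn (Weighted m r) (shiftedCounter {n} e)
  Weighted-shiftedCounter r e deg-e = SupportedOn-⊕ (counter e) (const (- 1ℚ))
    (SupportedOn-⨁ (λ i → embed i e) λ i → SupportedOn-mono (embed i e)
       (λ { β (x , refl , x≤) → unitᵛ i r , ℕP.≤-reflexive (tdeg-unitᵛ i r)
                              , subst (unitᵛ i x ≤ᵛ_) (sym (map-unitᵛ i r)) (unitᵛ-mono i (subst (_≤ suc m ℕ.* r) (ℕP.+-identityʳ x) x≤)) })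
       (SupportedOn-embed i e deg-e))
    (Weighted-mono (const (- 1ℚ)) z≤n (Weighted-const (- 1ℚ)))
    where
    map-unitᵛ : ∀ {k} (i : Fin k) x → V.map (suc m ℕ.*_) (unitᵛ i x) ≡ unitᵛ i (suc m ℕ.* x)
    map-unitᵛ {suc k} Fin.zero    x = cong (suc m ℕ.* x ∷_) (trans (VP.map-replicate (suc m ℕ.*_) 0 k) (cong (replicate k) (ℕP.*-zeroʳ (suc m))))
    map-unitᵛ {suc k} (Fin.suc i) x = cong₂ _∷_ (ℕP.*-zeroʳ (suc m)) (map-unitᵛ i x)

Vsum-tabulate : ∀ {k} (f : Fin k → ℕ) → V.sum (tabulate f) ≡ ℕΣ.sum f
Vsum-tabulate {zero}  f = refl
Vsum-tabulate {suc k} f = cong (f Fin.zero ℕ.+_) (Vsum-tabulate (f ∘ Fin.suc))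

tdeg≡sum-lookup : ∀ {n} (t : Exp n) → tdeg t ≡ ℕΣ.sum (lookup t)
tdeg≡sum-lookup []      = refl
tdeg≡sum-lookup (x ∷ t) = cong (x ℕ.+_) (tdeg≡sum-lookup t)

ℕΣ-mono : ∀ {k} (f g : Fin k → ℕ) → (∀ i → f i ≤ g i) → ℕΣ.sum f ≤ ℕΣ.sum g
ℕΣ-mono {zero}  f g f≤g = z≤n
ℕΣ-mono {suc k} f g f≤g = ℕP.+-mono-≤ (f≤g Fin.zero) (ℕΣ-mono (f ∘ Fin.suc) (g ∘ Fin.suc) (f≤g ∘ Fin.suc))

ℕΣ-indicator : ∀ {n} (x : Fin n) → ℕΣ.sum (λ i → if does (x Fin.≟ i) then 1 else 0) ≡ 1
ℕΣ-indicator {suc n} Fin.zero    = cong suc (ℕΣ.sum-replicate-zero n)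
ℕΣ-indicator {suc n} (Fin.suc x) = ℕΣ-indicator x

ℕΣ-ones : ∀ k → ℕΣ.sum (λ (_ : Fin k) → 1) ≡ k
ℕΣ-ones zero    = refl
ℕΣ-ones (suc k) = cong suc (ℕΣ-ones k)

countPre-sum : ∀ {k n} (ι : Fin k → Fin n) → ℕΣ.sum (countPre ι) ≡ k
countPre-sum {k} {n} ι = begin
  ℕΣ.sum (countPre ι)                                                     ≡⟨ ℕΣ.sum-cong-≗ (λ i → Vsum-tabulate (λ j → if does (ι j Fin.≟ i) then 1 else 0)) ⟩
  ℕΣ.sum (λ i → ℕΣ.sum (λ j → if does (ι j Fin.≟ i) then 1 else 0))       ≡⟨ ℕΣ.∑-comm (λ i j → if does (ι j Fin.≟ i) then 1 else 0) ⟩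
  ℕΣ.sum (λ j → ℕΣ.sum (λ i → if does (ι j Fin.≟ i) then 1 else 0))       ≡⟨ ℕΣ.sum-cong-≗ (λ j → ℕΣ-indicator (ι j)) ⟩
  ℕΣ.sum (λ (_ : Fin k) → 1)                                              ≡⟨ ℕΣ-ones k ⟩
  k                                                                       ∎
  where open ≡-Reasoning

-- If x^e divides x^m⃗ x^((m+1) t), each variable can absorb at most tᵢ of the k factors x_{ι j}^(m+1).
¬DivBy-bounded : ∀ {n} m k (ι : Fin k → Fin n) (e t : Exp n) →
  (∀ i → lookup e i ≤ m ℕ.+ suc m ℕ.* lookup t i) → tdeg t < k → ¬ DivBy m k ι e
¬DivBy-bounded {n} m k ι e t e≤ t<k divides = ℕP.<⇒≱ t<k (begin
  k                      ≡⟨ sym (countPre-sum ι) ⟩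
  ℕΣ.sum (countPre ι)    ≤⟨ ℕΣ-mono (countPre ι) (lookup t) (λ i → cancel (ℕP.≤-trans (divides i) (e≤ i))) ⟩
  ℕΣ.sum (lookup t)      ≡⟨ sym (tdeg≡sum-lookup t) ⟩
  tdeg t                 ∎)
  where
  open ℕP.≤-Reasoning
  cancel : ∀ {c u} → suc m ℕ.* c ≤ m ℕ.+ suc m ℕ.* u → c ≤ u
  cancel {c} {u} le = ℕP.≤-pred (ℕP.*-cancelˡ-< (suc m) c (suc u) (subst (suc m ℕ.* c <_) (sym (ℕP.*-suc (suc m) u)) (s≤s le)))

lookup-unitᵛ-≢ : ∀ {n} {i j : Fin n} x → i ≢ j → lookup (unitᵛ j x) i ≡ 0
lookup-unitᵛ-≢ {n} {i} {j} x i≢j = trans (VP.lookup∘updateAt′ i j i≢j 0ᵛ) (VP.lookup-replicate i 0)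

basisVector≡ : ∀ n m d (j : Fin n) →
  tabulate (λ i → m ℕ.+ suc m ℕ.* lookup (replicate n 0) i ℕ.+ (if does (i Fin.≟ j) then d else 0)) ≡ replicate n m +ᵛ unitᵛ j d
basisVector≡ n m d j = trans (VP.tabulate-cong entry) (VP.tabulate∘lookup (replicate n m +ᵛ unitᵛ j d))
  where
  entry : ∀ i → m ℕ.+ suc m ℕ.* lookup (replicate n 0) i ℕ.+ (if does (i Fin.≟ j) then d else 0) ≡ lookup (replicate n m +ᵛ unitᵛ j d) i
  entry i rewrite VP.lookup-zipWith ℕ._+_ i (replicate n m) (unitᵛ j d) | VP.lookup-replicate i m | VP.lookup-replicate i 0
                | ℕP.*-zeroʳ (suc m) | ℕP.+-identityʳ m with i Fin.≟ j
  ... | yes refl = cong (m ℕ.+_) (sym (lookup-unitᵛ i d))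
  ... | no i≢j   = cong (m ℕ.+_) (sym (lookup-unitᵛ-≢ d i≢j))

basisCoeff≡sum : ∀ {n} m d (e : Exp n) →
  basisCoeff m d (replicate n 0) e ≡ ℚΣ.sum (λ j → if does (e ≟ₑ (replicate n m +ᵛ unitᵛ j d)) then 1ℚ else 0ℚ)
basisCoeff≡sum {n} m d e = trans (cong ℕtoℚ (Vsum-tabulate indicator)) (trans (ℕtoℚ-sum indicator) (ℚΣ.sum-cong-≗ term))
  where
  indicator : Fin n → ℕ
  indicator j = if does (e ≟ₑ tabulate (λ i → m ℕ.+ suc m ℕ.* lookup (replicate n 0) i ℕ.+ (if does (i Fin.≟ j) then d else 0))) then 1 else 0
  ℕtoℚ-if : ∀ b → ℕtoℚ (if b then 1 else 0) ≡ (if b then 1ℚ else 0ℚ)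
  ℕtoℚ-if true  = refl
  ℕtoℚ-if false = refl
  term : ∀ j → ℕtoℚ (indicator j) ≡ (if does (e ≟ₑ (replicate n m +ᵛ unitᵛ j d)) then 1ℚ else 0ℚ)
  term j = trans (ℕtoℚ-if (does (e ≟ₑ _))) (cong (λ v → if does (e ≟ₑ v) then 1ℚ else 0ℚ) (basisVector≡ n m d j))

basisCoeff-off : ∀ {n} m d (e : Exp n) → (∀ j → e ≢ replicate n m +ᵛ unitᵛ j d) → basisCoeff m d (replicate n 0) e ≡ 0ℚ
basisCoeff-off {n} m d e off = trans (basisCoeff≡sum m d e) (trans (ℚΣ.sum-cong-≗ term) (ℚΣ.sum-replicate-zero n))
  where
  term : ∀ j → (if does (e ≟ₑ (replicate n m +ᵛ unitᵛ j d)) then 1ℚ else 0ℚ) ≡ 0ℚ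
  term j rewrite dec-false (e ≟ₑ (replicate n m +ᵛ unitᵛ j d)) (off j) = refl

basisCoeff-shift : ∀ {n} m d (e : Exp n) → replicate n m ≤ᵛ e → basisCoeff m d (replicate n 0) e ≡ axisCount (e ∸ᵛ replicate n m) d
basisCoeff-shift {n} m d e m⃗≤e = trans (basisCoeff≡sum m d e) (ℚΣ.sum-cong-≗ term)
  where
  m⃗ = replicate n m
  term : ∀ j → (if does (e ≟ₑ (m⃗ +ᵛ unitᵛ j d)) then 1ℚ else 0ℚ) ≡ (if does ((e ∸ᵛ m⃗) ≟ₑ unitᵛ j d) then 1ℚ else 0ℚ)
  term j with e ≟ₑ (m⃗ +ᵛ unitᵛ j d) | (e ∸ᵛ m⃗) ≟ₑ unitᵛ j d
  ... | yes _    | yes _ = refl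
  ... | no _     | no _  = refl
  ... | yes refl | no ≢  = ⊥-elim (≢ (+ᵛ-∸ᵛ-cancelˡ m⃗ (unitᵛ j d)))
  ... | no ≢     | yes ≡ = ⊥-elim (≢ (trans (sym (+ᵛ-∸ᵛ m⃗≤e)) (cong (m⃗ +ᵛ_) ≡)))

-- Assembling P = G ⊗ H

phiCoeff-top : ∀ {n} m k (P : Poly n) e → tdeg e ≡ topDeg m n k → phiCoeff m k P e ≡ coeff P e
phiCoeff-top {n} m k P e e≡ = cong (λ b → if b then coeff P e else 0ℚ) (dec-true (tdeg e ℕ.≟ topDeg m n k) e≡)

phiCoeff-off : ∀ {n} m k (P : Poly n) e → tdeg e ≢ topDeg m n k → phiCoeff m k P e ≡ 0ℚ
phiCoeff-off {n} m k P e e≢ = cong (λ b → if b then coeff P e else 0ℚ) (dec-false (tdeg e ℕ.≟ topDeg m n k) e≢)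

Represents-single : ∀ {n} m k (P : Poly n) c d l → (∀ e → phiCoeff m k P e ≡ c * basisCoeff m d l e) →
  Represents m k ((c , (d , l)) ∷ []) P
Represents-single m k P c d l φ≡ e = trans (φ≡ e) (sym (ℚP.+-identityʳ (c * basisCoeff m d l e)))

baseDegree : ℕ → ℕ → ℕ
baseDegree m k = suc m ℕ.* (k ∸ 1) ∸ 1

record Factor (m k n : ℕ) : Set where
  field
    poly     : Poly n
    lc       : ℚ
    lc≢0     : lc ≢ 0ℚ
    degree   : DegreeAtMost (baseDegree m k) poly
    weighted : SupportedOn (Weighted m (k ∸ 1)) poly
    top      : ∀ γ → tdeg γ ≡ baseDegree m k → coeff poly γ ≡ lc * axisCount γ (baseDegree m k)
    mult     : ∀ a → InGrid m a → 1 ≤ nonzeroCount a → nonzeroCount a < k → MultAtLeast (k ∸ nonzeroCount a) poly a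

module FromFactor {m k n : ℕ} (2≤k : 2 ≤ k) (H : Factor m k n) where
  open Factor H

  m⃗ : Exp n
  m⃗ = replicate n m
  D = baseDegree m k
  P = G n m ⊗ poly
  c₀ = coeff (G n m) m⃗ * lc
  R : Comb n
  R = (c₀ , (D , 0ᵛ)) ∷ []

  topDeg≡ : topDeg m n k ≡ tdeg m⃗ ℕ.+ D
  topDeg≡ = trans (ℕP.+-∸-assoc (m ℕ.* n) 1≤) (cong (ℕ._+ D) (trans (ℕP.*-comm m n) (sym (trans (tdeg-replicate n m) (ℕP.*-comm m n)))))
    where 1≤ = ℕP.≤-trans (ℕP.∸-monoˡ-≤ 1 2≤k) (ℕP.m≤m+n (k ∸ 1) (m ℕ.* (k ∸ 1)))

  P-inV : InV m k P
  P-inV = (λ e ≢0 → subst (tdeg e ≤_) (sym topDeg≡) (degree-P e ≢0))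
        , λ e ≢0 ι → bounded e (SupportedOn-⊗ (G n m) poly (G-support n m) weighted e ≢0) ι
    where
    degree-P : DegreeAtMost (tdeg m⃗ ℕ.+ D) P
    degree-P = DegreeAtMost-⊗ (G n m) poly (SupportedOn-mono (G n m) (λ β → tdeg-mono-≤ᵛ) (G-support n m)) degree
    bounded : ∀ e → (∃₂ λ β₁ β₂ → e ≡ β₁ +ᵛ β₂ × β₁ ≤ᵛ m⃗ × Weighted m (k ∸ 1) β₂) → ∀ ι → ¬ DivBy m k ι e
    bounded e (β₁ , β₂ , refl , β₁≤ , (t , t≤ , β₂≤)) ι =
      ¬DivBy-bounded m k ι (β₁ +ᵛ β₂) t entry (ℕP.≤-<-trans t≤ (ℕP.∸-monoʳ-< (s≤s z≤n) (ℕP.≤-trans (s≤s z≤n) 2≤k)))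
      where
      entry : ∀ i → lookup (β₁ +ᵛ β₂) i ≤ m ℕ.+ suc m ℕ.* lookup t i
      entry i = subst (_≤ m ℕ.+ suc m ℕ.* lookup t i) (sym (VP.lookup-zipWith ℕ._+_ i β₁ β₂))
        (ℕP.+-mono-≤ (subst (lookup β₁ i ≤_) (VP.lookup-replicate i m) (Pointwise.lookup β₁≤ i))
                     (subst (lookup β₂ i ≤_) (VP.lookup-map i (suc m ℕ.*_) t) (Pointwise.lookup β₂≤ i)))

  P-mult : ∀ a → InGrid m a → a ≢ 0ᵛ → MultAtLeast k P a
  P-mult a a∈grid a≢0 with nonzeroCount a ℕ.≟ 0 | nonzeroCount a ℕP.<? k
  ... | yes s≡0 | _     = ⊥-elim (a≢0 (nonzeroCount≡0⇒≡0ᵛ a s≡0))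
  ... | no s≢0  | yes s<k = subst (λ r → MultAtLeast r P a) (ℕP.m+[n∸m]≡n (ℕP.<⇒≤ s<k))
    (MultAtLeast-⊗ (G n m) poly a (G-mult m a a∈grid) (mult a a∈grid (ℕP.n≢0⇒n>0 s≢0) s<k))
  ... | no _    | no s≮k  = MultAtLeast-mono P a (ℕP.≤-trans (ℕP.≮⇒≥ s≮k) (ℕP.m≤m+n (nonzeroCount a) 0))
    (MultAtLeast-⊗ (G n m) poly a (G-mult m a a∈grid) (MultAtLeast-zero poly a))

  P-top : ∀ e → tdeg e ≡ tdeg m⃗ ℕ.+ D → coeff P e ≡ c₀ * basisCoeff m D (replicate n 0) e
  P-top e e≡ = by-support (Pointwise.decidable ℕP._≤?_ m⃗ e)
    where
    module Top = TopCoefficient (G n m) poly m⃗ D e (G-support n m) degree e≡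
    by-support : Dec (m⃗ ≤ᵛ e) → coeff P e ≡ c₀ * basisCoeff m D (replicate n 0) e
    by-support (yes m⃗≤e) = begin
      coeff P e                                     ≡⟨ Top.coeff-⊗-top m⃗≤e ⟩
      coeff (G n m) m⃗ * coeff poly (e ∸ᵛ m⃗)         ≡⟨ cong (coeff (G n m) m⃗ *_) (top (e ∸ᵛ m⃗) rest≡D) ⟩
      coeff (G n m) m⃗ * (lc * axisCount (e ∸ᵛ m⃗) D) ≡⟨ sym (ℚP.*-assoc (coeff (G n m) m⃗) lc (axisCount (e ∸ᵛ m⃗) D)) ⟩
      c₀ * axisCount (e ∸ᵛ m⃗) D                     ≡⟨ cong (c₀ *_) (sym (basisCoeff-shift m D e m⃗≤e)) ⟩
      c₀ * basisCoeff m D (replicate n 0) e         ∎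
      where
      open ≡-Reasoning
      rest≡D : tdeg (e ∸ᵛ m⃗) ≡ D
      rest≡D = ℕP.+-cancelˡ-≡ (tdeg m⃗) (tdeg (e ∸ᵛ m⃗)) D (trans (tdeg-∸ᵛ m⃗≤e) e≡)
    by-support (no m⃗≰e) = trans (Top.coeff-⊗-top-≰ m⃗≰e) (sym (trans (cong (c₀ *_) (basisCoeff-off m D e off)) (ℚP.*-zeroʳ c₀)))
      where
      off : ∀ j → e ≢ m⃗ +ᵛ unitᵛ j D
      off j e≡ = m⃗≰e (subst (m⃗ ≤ᵛ_) (sym e≡) (≤ᵛ-+ᵛ m⃗ (unitᵛ j D)))

  P-represented : Represents m k R P
  P-represented = Represents-single m k P c₀ D 0ᵛ λ e → by-degree e (tdeg e ℕ.≟ topDeg m n k)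
    where
    by-degree : ∀ e → Dec (tdeg e ≡ topDeg m n k) → phiCoeff m k P e ≡ c₀ * basisCoeff m D (replicate n 0) e
    by-degree e (yes e≡) = trans (phiCoeff-top m k P e e≡) (P-top e (trans e≡ topDeg≡))
    by-degree e (no e≢)  = trans (phiCoeff-off m k P e e≢) (sym (trans (cong (c₀ *_) (basisCoeff-off m D e off)) (ℚP.*-zeroʳ c₀)))
      where
      off : ∀ j → e ≢ m⃗ +ᵛ unitᵛ j D
      off j refl = e≢ (trans (tdeg-+ᵛ m⃗ (unitᵛ j D)) (trans (cong (tdeg m⃗ ℕ.+_) (tdeg-unitᵛ j D)) (sym topDeg≡)))

  R-admissible : All (λ t → Admissible m k (proj₂ t)) R
  R-admissible = trans (cong (λ z → D ℕ.+ suc m ℕ.* z) (tdeg-0ᵛ n)) (trans (cong (D ℕ.+_) (ℕP.*-zeroʳ (suc m))) (ℕP.+-identityʳ D)) ∷ []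

  R-coeffOfB0 : coeffOfB0 m k R ≢ 0ℚ
  R-coeffOfB0 rewrite dec-true (D ℕ.≟ D) refl | dec-true (0ᵛ {n} ≟ₑ 0ᵛ) refl =
    subst (_≢ 0ℚ) (sym (ℚP.+-identityʳ c₀)) (*-≢0 (G-top n m) lc≢0)

  construction : ∃ λ (P : Poly n) → InU m k P ×
                   ∃ λ (R : Comb n) → All (λ t → Admissible m k (proj₂ t)) R × Represents m k R P × coeffOfB0 m k R ≢ 0ℚ
  construction = P , (P-inV , P-mult) , R , R-admissible , P-represented , R-coeffOfB0

module _ (m′ n : ℕ) where
  private
    m = suc m′
    module I₁ = Indicator (indicator₁ m′)
    module I₂ = Indicator (indicator₂ m′)
    module I₃ = Indicator (indicator₃ m′)
    e₁ = I₁.poly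
    e₂ = I₂.poly
    e₃ = I₃.poly
    Y₁ Y₂ Y₃ : Poly n
    Y₁ = shiftedCounter e₁
    Y₂ = shiftedCounter e₂
    Y₃ = shiftedCounter e₃

    Y₁-degree = shiftedCounter-degree {n} e₁ I₁.degree
    Y₂-degree = shiftedCounter-degree {n} e₂ I₂.degree
    Y₃-degree = shiftedCounter-degree {n} e₃ I₃.degree

    Y-weight : ∀ r e → DegreeAtMost (suc m ℕ.* r ∸ 1) e → SupportedOn (Weighted m r) (shiftedCounter {n} e)
    Y-weight r e deg-e = Weighted-shiftedCounter m r e (DegreeAtMost-mono e (ℕP.m∸n≤m (suc m ℕ.* r) 1) deg-e)

    Y₁²-degree = DegreeAtMost-⊗ Y₁ Y₁ Y₁-degree Y₁-degree
    Y₁³-degree = DegreeAtMost-⊗ Y₁ (Y₁ ⊗ Y₁) Y₁-degree Y₁²-degree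
    Y₂Y₁-degree = DegreeAtMost-⊗ Y₂ Y₁ Y₂-degree Y₁-degree

    Y₁-weight = Y-weight 1 e₁ I₁.degree
    Y₂-weight = Y-weight 2 e₂ I₂.degree
    Y₃-weight = Y-weight 3 e₃ I₃.degree

    2D₁<D₂ : m ℕ.* 1 ℕ.+ m ℕ.* 1 < 1 ℕ.+ m ℕ.* 2
    2D₁<D₂ = s≤s (ℕP.≤-reflexive (solveℕ 1 (λ x → x :*ℕ conℕ 1 :+ℕ x :*ℕ conℕ 1 :=ℕ x :*ℕ conℕ 2) refl m))
    3D₁<D₃ : m ℕ.* 1 ℕ.+ (m ℕ.* 1 ℕ.+ m ℕ.* 1) < 2 ℕ.+ m ℕ.* 3
    3D₁<D₃ = ℕP.m≤n⇒m≤1+n (s≤s (ℕP.≤-reflexive (solveℕ 1 (λ x → x :*ℕ conℕ 1 :+ℕ (x :*ℕ conℕ 1 :+ℕ x :*ℕ conℕ 1) :=ℕ x :*ℕ conℕ 3) refl m)))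
    D₂+D₁<D₃ : 1 ℕ.+ m ℕ.* 2 ℕ.+ m ℕ.* 1 < 2 ℕ.+ m ℕ.* 3
    D₂+D₁<D₃ = s≤s (s≤s (ℕP.≤-reflexive (solveℕ 1 (λ x → x :*ℕ conℕ 2 :+ℕ x :*ℕ conℕ 1 :=ℕ x :*ℕ conℕ 3) refl m)))

  factor₂ : Factor m 2 n
  factor₂ = record
    { poly     = H₂ e₁
    ; lc       = coeff e₁ (baseDegree m 2 ∷ [])
    ; lc≢0     = I₁.top≢0
    ; degree   = Y₁-degree
    ; weighted = Y₁-weight
    ; top      = λ γ γ≡D → coeff-shiftedCounter-top e₁ (baseDegree m 2) γ (s≤s z≤n) γ≡D
    ; mult     = mult
    }
    where
    mult : ∀ a → InGrid m a → 1 ≤ nonzeroCount a → nonzeroCount a < 2 → MultAtLeast (2 ∸ nonzeroCount a) (H₂ e₁) a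
    mult a a∈grid 1≤s s<2 with nonzeroCount a in s≡
    ... | 1 = H₂-mult I₁.isFlat a a∈grid s≡
    ... | suc (suc _) = ⊥-elim (ℕP.<⇒≱ s<2 (s≤s (s≤s z≤n)))

  factor₃ : Factor m 3 n
  factor₃ = record
    { poly     = H₃ e₁ e₂
    ; lc       = coeff e₂ (baseDegree m 3 ∷ [])
    ; lc≢0     = I₂.top≢0
    ; degree   = SupportedOn-⊕ Y₂ ((- 1ℚ) · (Y₁ ⊗ Y₁)) Y₂-degree
                   (SupportedOn-· (- 1ℚ) (Y₁ ⊗ Y₁) (DegreeAtMost-mono (Y₁ ⊗ Y₁) (ℕP.<⇒≤ 2D₁<D₂) Y₁²-degree))
    ; weighted = SupportedOn-⊕ Y₂ ((- 1ℚ) · (Y₁ ⊗ Y₁)) Y₂-weight (SupportedOn-· (- 1ℚ) (Y₁ ⊗ Y₁) (Weighted-⊗ m Y₁ Y₁ Y₁-weight Y₁-weight))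
    ; top      = λ γ γ≡D → trans (coeff-⊕-lower Y₂ ((- 1ℚ) · (Y₁ ⊗ Y₁)) γ (SupportedOn-· (- 1ℚ) (Y₁ ⊗ Y₁) Y₁²-degree)
                                                (subst (_ <_) (sym γ≡D) 2D₁<D₂))
                                 (coeff-shiftedCounter-top e₂ (baseDegree m 3) γ (s≤s z≤n) γ≡D)
    ; mult     = mult
    }
    where
    mult : ∀ a → InGrid m a → 1 ≤ nonzeroCount a → nonzeroCount a < 3 → MultAtLeast (3 ∸ nonzeroCount a) (H₃ e₁ e₂) a
    mult a a∈grid 1≤s s<3 with nonzeroCount a in s≡
    ... | 1 = H₃-mult-1 I₁.isFlat a a∈grid I₂.isFlat s≡
    ... | 2 = H₃-mult-2 I₁.isFlat a a∈grid I₂.isFlat s≡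
    ... | suc (suc (suc _)) = ⊥-elim (ℕP.<⇒≱ s<3 (s≤s (s≤s (s≤s z≤n))))

  factor₄ : Factor m 4 n
  factor₄ = record
    { poly     = H₄ e₁ e₂ e₃
    ; lc       = coeff e₃ (baseDegree m 4 ∷ [])
    ; lc≢0     = I₃.top≢0
    ; degree   = SupportedOn-⊕ (Y₃ ⊕ A) B (SupportedOn-⊕ Y₃ A Y₃-degree (DegreeAtMost-mono A (ℕP.<⇒≤ 3D₁<D₃) A-degree))
                   (DegreeAtMost-mono B (ℕP.<⇒≤ D₂+D₁<D₃) B-degree)
    ; weighted = SupportedOn-⊕ (Y₃ ⊕ A) B
                   (SupportedOn-⊕ Y₃ A Y₃-weight (SupportedOn-· ½ (Y₁ ⊗ (Y₁ ⊗ Y₁)) (Weighted-⊗ m Y₁ (Y₁ ⊗ Y₁) Y₁-weight (Weighted-⊗ m Y₁ Y₁ Y₁-weight Y₁-weight))))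
                   (SupportedOn-· (- ³⁄₂) (Y₂ ⊗ Y₁) (Weighted-⊗ m Y₂ Y₁ Y₂-weight Y₁-weight))
    ; top      = λ γ γ≡D → trans (coeff-⊕-lower (Y₃ ⊕ A) B γ B-degree (subst (_ <_) (sym γ≡D) D₂+D₁<D₃))
                          (trans (coeff-⊕-lower Y₃ A γ A-degree (subst (_ <_) (sym γ≡D) 3D₁<D₃))
                                 (coeff-shiftedCounter-top e₃ (baseDegree m 4) γ (s≤s z≤n) γ≡D))
    ; mult     = mult
    }
    where
    A = ½ · (Y₁ ⊗ (Y₁ ⊗ Y₁))
    B = (- ³⁄₂) · (Y₂ ⊗ Y₁)
    A-degree = SupportedOn-· ½ (Y₁ ⊗ (Y₁ ⊗ Y₁)) Y₁³-degree
    B-degree = SupportedOn-· (- ³⁄₂) (Y₂ ⊗ Y₁) Y₂Y₁-degree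
    mult : ∀ a → InGrid m a → 1 ≤ nonzeroCount a → nonzeroCount a < 4 → MultAtLeast (4 ∸ nonzeroCount a) (H₄ e₁ e₂ e₃) a
    mult a a∈grid 1≤s s<4 with nonzeroCount a in s≡
    ... | 1 = H₄-mult-1 I₁.isFlat a a∈grid I₂.isFlat I₃.isFlat s≡
    ... | 2 = H₄-mult-2 I₁.isFlat a a∈grid I₂.isFlat I₃.isFlat s≡
    ... | 3 = H₄-mult-3 I₁.isFlat a a∈grid I₂.isFlat I₃.isFlat s≡
    ... | suc (suc (suc (suc _))) = ⊥-elim (ℕP.<⇒≱ s<4 (s≤s (s≤s (s≤s (s≤s z≤n)))))

-- The hypothesis n ≥ k − 1 is only needed in the paper to make ℬ_{m,k} linearly independent.
lemma4p5 : (m k n : ℕ) → 1 ≤ m → 2 ≤ k → k ≤ 4 → k ∸ 1 ≤ n →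
    ∃ λ (P : Poly n) → InU m k P ×
    ∃ λ (R : Comb n) → All (λ t → Admissible m k (proj₂ t)) R ×
    Represents m k R P × coeffOfB0 m k R ≢ 0ℚ
lemma4p5 (suc m′) 2 n _ 2≤k _ _ = FromFactor.construction 2≤k (factor₂ m′ n)
lemma4p5 (suc m′) 3 n _ 2≤k _ _ = FromFactor.construction 2≤k (factor₃ m′ n)
lemma4p5 (suc m′) 4 n _ 2≤k _ _ = FromFactor.construction 2≤k (factor₄ m′ n)
lemma4p5 zero     k n () _ _ _
lemma4p5 (suc m′) 0 n _ () _ _
lemma4p5 (suc m′) 1 n _ (s≤s ()) _ _
lemma4p5 (suc m′) (suc (suc (suc (suc (suc _))))) n _ _ (s≤s (s≤s (s≤s (s≤s ())))) _
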